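{- Let $p$ be an odd prime, $b\in\mathbb Z_p$ with $\langle b\rangle_p>p/2$, and let $s=(b-\langle b\rangle_p)/p$ with $s\not\equiv-1\pmod p$. Then, modulo $p^2$, $$\sum_{k=0}^{p-1}\frac{\binom{2k}k^2}{16^k}\cdot\frac p{k+b}\equiv\sum_{k=0}^{(p-1)/2}\frac{\binom{2k}k^2}{16^k}\cdot\frac p{k+b}\equiv\frac{\binom{2(\langle b\rangle_p-\frac{p+1}2)}{\langle b\rangle_p-\frac{p+1}2}^2}{(s+1)16^{\langle b\rangle_p-\frac{p+1}2}}\Big(1+p(2s+1)\big(H_{p-\langle b\rangle_p}-H_{\langle b\rangle_p-\frac{p+1}2}\big)\Big)$$ $$\equiv\frac1{s+1}\binom{\frac{p-1}2}{p-\langle b\rangle_p}^2\Big(1+p\big(2q_p(2)+(2s+2)H_{p-\langle b\rangle_p}-(2s+1)H_{\langle b\rangle_p-\frac{p+1}2}\big)\Big)\equiv\frac{\binom{2(p-\langle b\rangle_p)}{p-\langle b\rangle_p}^2}{(s+1)16^{p-\langle b\rangle_p}}\Big(1+p(2s+2)\big(H_{p-\langle b\rangle_p}-H_{\langle b\rangle_p-\frac{p+1}2}\big)\Big).$$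
   Context: $\mathbb Z_p$ denotes the set of rational numbers whose denominator is not divisible by $p$; congruences are taken in this ring. For $b\in\mathbb Z_p$, $\langle b\rangle_p\in\{0,1,\dots,p-1\}$ is defined by $b\equiv\langle b\rangle_p\pmod p$. $q_p(2)=(2^{p-1}-1)/p$. $H_0=0$, $H_n=1+\frac12+\cdots+\frac1n$. -}

module Defs where

open import Data.Nat as ℕ using (ℕ; zero; suc)
open import Data.Nat.Divisibility using (_∣_)
open import Data.Nat.Combinatorics using (_C_)
open import Data.Integer as ℤ using (ℤ; +_; -[1+_])
open import Data.Rational as ℚ using (ℚ; mkℚ; 0ℚ; 1ℚ; _+_; _*_; _-_; 1/_)
open import Relation.Nullary using (¬_)

ι : ℕ → ℚ
ι n = (+ n) ℚ./ 1

-- total inverse: inv 0 = 0 (only ever applied to nonzero arguments in the statement)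
inv : ℚ → ℚ
inv (mkℚ (+ zero) _ _) = 0ℚ
inv q@(mkℚ (+ suc _) _ _) = 1/ q
inv q@(mkℚ -[1+ _ ] _ _) = 1/ q

_//_ : ℚ → ℚ → ℚ
x // y = x * inv y
infixl 7 _//_

InZp : ℕ → ℚ → Set
InZp p q = ¬ (p ∣ ℚ.denominatorℕ q)

Cong : ℕ → ℕ → ℚ → ℚ → Set
Cong p n x y = InZp p ((x - y) // ι (p ℕ.^ n))

sumTo : ℕ → (ℕ → ℚ) → ℚ
sumTo zero f = f zero
sumTo (suc n) f = sumTo n f + f (suc n)

H : ℕ → ℚ
H zero = 0ℚ
H (suc n) = H n + inv (ι (suc n))

q2 : ℕ → ℚ
q2 p = (ι (2 ℕ.^ (p ℕ.∸ 1)) - 1ℚ) // ι p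

c : ℕ → ℚ
c k = ι (((2 ℕ.* k) C k) ℕ.^ 2) // ι (16 ℕ.^ k)

-- Write p = 2n + 1, b = r + p·s with n < r < p, and t = p - r,
-- a = r - n - 1 (so a + t = n).  Modulo p² the summand c k = C(2k,k)²/16^k
-- vanishes for n < k < p and agrees with
--   Q n k = Π_{j<k} ((2j+1)² - p²)/(2j+2)²
-- for k ≤ n.  An exact partial-fraction identity turns Σ_{k≤n} Q n k/(x+k) into
-- the rational function Π_{j<n}(j+1-x)/Π_{j≤n}(x+j).  At x = b exactly one
-- factor of the denominator, b + t = p(s+1), is divisible by p; expanding all
-- other factors to first order in p yields the closed form E.  The forms C₁ and
-- D follow from the expansions c k ≡ C(n,k)²(1 + 2p Σ_{j<k} 1/(2j+1)) and the
-- classical congruences H_{p-1-m} ≡ H_m (mod p) and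
-- q_p(2) ≡ Σ_{j<n} 1/(2j+1) (mod p).
module Submission where

open import Defs
open import Data.Nat using (ℕ; zero; suc; _<_; _≤_; _∸_; s≤s; z≤n)
open import Data.Nat.DivMod using (_/_; _%_)
open import Data.Nat.Primality using (Prime)
open import Data.Nat.Combinatorics using (_C_)
open import Data.Rational using (ℚ; _+_; _*_; _-_; 0ℚ; 1ℚ; -_)
open import Data.Product using (_×_; _,_)
open import Relation.Nullary using (¬_)
open import Relation.Binary.PropositionalEquality using (_≡_)
import Data.Nat as ℕ


module RationalField where
  import Data.Nat.Properties as NP
  open import Data.Integer as ℤ using (ℤ; +_; -[1+_])
  import Data.Integer.Properties as ℤP
  open import Data.Rational as ℚ using (mkℚ)
  import Data.Rational.Properties as ℚP
  import Data.Rational.Unnormalised as U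
  import Data.Rational.Unnormalised.Properties as UP
  import Data.Nat.Coprimality as Cop
  open import Relation.Binary.PropositionalEquality
  open import Relation.Nullary using (yes; no)
  open import Data.Empty using (⊥-elim)
  open import Function using (case_of_)
  open import Data.Rational.Solver using (module +-*-Solver)
  open +-*-Solver
  open ≡-Reasoning

  embedℤ : ℤ → ℚ
  embedℤ z = z ℚ./ 1

  embedℤ-mk : ∀ z → embedℤ z ≡ mkℚ z 0 (Cop.sym (Cop.1-coprimeTo _))
  embedℤ-mk z = ℚP.↥p/↧p≡p (mkℚ z 0 (Cop.sym (Cop.1-coprimeTo _)))

  embedℤ-+ : ∀ a b → embedℤ (a ℤ.+ b) ≡ embedℤ a + embedℤ b
  embedℤ-+ a b rewrite embedℤ-mk (a ℤ.+ b) | embedℤ-mk a | embedℤ-mk b =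
    ℚP.toℚᵘ-injective (UP.≃-trans (U.*≡* denominators-one)
      (UP.≃-sym (ℚP.toℚᵘ-homo-+ (mkℚ a 0 (Cop.sym (Cop.1-coprimeTo _))) (mkℚ b 0 (Cop.sym (Cop.1-coprimeTo _))))))
    where
    denominators-one : (a ℤ.+ b) ℤ.* + 1 ≡ (a ℤ.* + 1 ℤ.+ b ℤ.* + 1) ℤ.* + 1
    denominators-one = cong (ℤ._* + 1) (sym (cong₂ ℤ._+_ (ℤP.*-identityʳ a) (ℤP.*-identityʳ b)))

  embedℤ-* : ∀ a b → embedℤ (a ℤ.* b) ≡ embedℤ a * embedℤ b
  embedℤ-* a b rewrite embedℤ-mk (a ℤ.* b) | embedℤ-mk a | embedℤ-mk b =
    ℚP.toℚᵘ-injective (UP.≃-trans (U.*≡* refl)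
      (UP.≃-sym (ℚP.toℚᵘ-homo-* (mkℚ a 0 (Cop.sym (Cop.1-coprimeTo _))) (mkℚ b 0 (Cop.sym (Cop.1-coprimeTo _))))))

  embedℤ-neg : ∀ a → embedℤ (ℤ.- a) ≡ - embedℤ a
  embedℤ-neg a rewrite embedℤ-mk (ℤ.- a) | embedℤ-mk a =
    ℚP.toℚᵘ-injective (UP.≃-trans (U.*≡* refl) (UP.≃-sym (ℚP.toℚᵘ-homo‿- (mkℚ a 0 _))))

  inv-l : ∀ x → x ≢ 0ℚ → inv x * x ≡ 1ℚ
  inv-l (mkℚ (+ zero) d c) x≢0 = ⊥-elim (x≢0 (ℚP.↥p≡0⇒p≡0 (mkℚ (+ zero) d c) refl))
  inv-l x@(mkℚ (+ suc n) d c) _ = ℚP.*-inverseˡ x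
  inv-l x@(mkℚ -[1+ n ] d c) _ = ℚP.*-inverseˡ x

  inv-r : ∀ x → x ≢ 0ℚ → x * inv x ≡ 1ℚ
  inv-r x nz = trans (ℚP.*-comm x (inv x)) (inv-l x nz)

  1≢0 : 1ℚ ≢ 0ℚ
  1≢0 ()

  mul-nz : ∀ x y → x ≢ 0ℚ → y ≢ 0ℚ → x * y ≢ 0ℚ
  mul-nz x y xn yn e = 1≢0 (begin
    1ℚ                          ≡⟨ sym (cong₂ _*_ (inv-l x xn) (inv-r y yn)) ⟩
    inv x * x * (y * inv y)     ≡⟨ solve 4 (λ a b c d → a :* b :* (c :* d) := a :* (b :* c) :* d) refl (inv x) x y (inv y) ⟩
    inv x * (x * y) * inv y     ≡⟨ cong (λ z → inv x * z * inv y) e ⟩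
    inv x * 0ℚ * inv y          ≡⟨ solve 2 (λ a b → a :* con 0ℚ :* b := con 0ℚ) refl (inv x) (inv y) ⟩
    0ℚ                          ∎)

  inv-unique : ∀ x y → x * y ≡ 1ℚ → inv x ≡ y
  inv-unique x y e = begin
    inv x               ≡⟨ sym (ℚP.*-identityʳ _) ⟩
    inv x * 1ℚ          ≡⟨ cong (inv x *_) (sym e) ⟩
    inv x * (x * y)     ≡⟨ sym (ℚP.*-assoc (inv x) x y) ⟩
    inv x * x * y       ≡⟨ cong (_* y) (inv-l x x≢0) ⟩
    1ℚ * y              ≡⟨ ℚP.*-identityˡ y ⟩
    y                   ∎
    where
    x≢0 : x ≢ 0ℚ
    x≢0 x≡0 = 1≢0 (trans (sym e) (trans (cong (_* y) x≡0) (ℚP.*-zeroˡ y)))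

  inv-* : ∀ x y → x ≢ 0ℚ → y ≢ 0ℚ → inv (x * y) ≡ inv x * inv y
  inv-* x y xn yn = inv-unique (x * y) (inv x * inv y) (begin
    x * y * (inv x * inv y)     ≡⟨ solve 4 (λ a b c d → a :* b :* (c :* d) := (a :* c) :* (b :* d)) refl x y (inv x) (inv y) ⟩
    (x * inv x) * (y * inv y)   ≡⟨ cong₂ _*_ (inv-r x xn) (inv-r y yn) ⟩
    1ℚ                          ∎)

  inv-neg : ∀ x → inv (- x) ≡ - inv x
  inv-neg x with x ℚP.≟ 0ℚ
  ... | yes refl = refl
  ... | no xn = inv-unique (- x) (- inv x) (trans (solve 2 (λ a b → (:- a) :* (:- b) := a :* b) refl x (inv x)) (inv-r x xn))

  div-eq : ∀ a c y → y ≢ 0ℚ → a ≡ c * y → a * inv y ≡ c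
  div-eq a c y yn e = begin
    a * inv y           ≡⟨ cong (_* inv y) e ⟩
    c * y * inv y       ≡⟨ ℚP.*-assoc c y (inv y) ⟩
    c * (y * inv y)     ≡⟨ cong (c *_) (inv-r y yn) ⟩
    c * 1ℚ              ≡⟨ ℚP.*-identityʳ c ⟩
    c                   ∎

  cancelR : ∀ a b c → c ≢ 0ℚ → a * c ≡ b * c → a ≡ b
  cancelR a b c cn e = begin
    a               ≡⟨ sym (div-eq (a * c) a c cn refl) ⟩
    a * c * inv c   ≡⟨ cong (_* inv c) e ⟩
    b * c * inv c   ≡⟨ div-eq (b * c) b c cn refl ⟩
    b               ∎

  ι-+ : ∀ m n → ι (m ℕ.+ n) ≡ ι m + ι n
  ι-+ m n = trans (cong embedℤ (ℤP.pos-+ m n)) (embedℤ-+ (+ m) (+ n))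

  ι-* : ∀ m n → ι (m ℕ.* n) ≡ ι m * ι n
  ι-* m n = trans (cong embedℤ (ℤP.pos-* m n)) (embedℤ-* (+ m) (+ n))

  ι-suc : ∀ n → ι (suc n) ≡ 1ℚ + ι n
  ι-suc n = ι-+ 1 n

  ι-nz : ∀ n → ι (suc n) ≢ 0ℚ
  ι-nz n e with ℚP.p≡0⇒↥p≡0 _ e
  ... | r rewrite embedℤ-mk (+ suc n) = case r of λ ()

  ιpos-nz : ∀ n → 0 < n → ι n ≢ 0ℚ
  ιpos-nz (suc n) _ = ι-nz n

  ι2 : ι 2 ≡ 1ℚ + 1ℚ
  ι2 = refl

  ι-minus : ∀ {j n} → j ≤ n → ι (n ∸ j) ≡ ι n - ι j
  ι-minus {j} {n} j≤n = begin
    ι (n ∸ j) ≡⟨ solve 2 (λ a b → a := (b :+ a) :- b) refl (ι (n ∸ j)) (ι j) ⟩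
    (ι j + ι (n ∸ j)) - ι j ≡⟨ cong (_- ι j) (sym (ι-+ j (n ∸ j))) ⟩
    ι (j ℕ.+ (n ∸ j)) - ι j ≡⟨ cong (λ v → ι v - ι j) (NP.m+[n∸m]≡n j≤n) ⟩
    ι n - ι j ∎

  ι-odd : ∀ n → ι (suc (n ℕ.+ n)) ≡ 1ℚ + ι n + ι n
  ι-odd n = trans (ι-suc (n ℕ.+ n)) (trans (cong (λ v → 1ℚ + v) (ι-+ n n)) (sym (ℚP.+-assoc 1ℚ (ι n) (ι n))))

  ι-ev : ∀ n → ι (suc (suc (n ℕ.+ n))) ≡ 1ℚ + 1ℚ + ι n + ι n
  ι-ev n = trans (ι-suc (suc (n ℕ.+ n))) (trans (cong (λ v → 1ℚ + v) (ι-odd n)) (solve 1 (λ x → con 1ℚ :+ (con 1ℚ :+ x :+ x) := con 1ℚ :+ con 1ℚ :+ x :+ x) refl (ι n)))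

  ι-sub-nz : ∀ {k m} → k < m → ι m - ι k ≢ 0ℚ
  ι-sub-nz {k} {m} k<m e = ιpos-nz (m ∸ k) (NP.m<n⇒0<n∸m k<m) (trans (ι-minus (NP.<⇒≤ k<m)) e)

  sq : ℚ → ℚ
  sq x = x * x


module IteratedOps where
  import Data.Rational.Properties as ℚP
  import Data.Nat.Properties as NP
  open import Relation.Binary.PropositionalEquality
  open import Data.Rational.Solver using (module +-*-Solver)
  open +-*-Solver
  open ≡-Reasoning
  open RationalField

  Π0 : ℕ → (ℕ → ℚ) → ℚ
  Π0 zero f = 1ℚ
  Π0 (suc k) f = Π0 k f * f k

  Σ0 : ℕ → (ℕ → ℚ) → ℚ
  Σ0 zero f = 0ℚ
  Σ0 (suc k) f = Σ0 k f + f k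

  Π0-cong : ∀ k {f g} → (∀ j → j < k → f j ≡ g j) → Π0 k f ≡ Π0 k g
  Π0-cong zero h = refl
  Π0-cong (suc k) h = cong₂ _*_ (Π0-cong k (λ j j<k → h j (NP.m<n⇒m<1+n j<k))) (h k (NP.n<1+n k))

  Σ0-cong : ∀ k {f g} → (∀ j → j < k → f j ≡ g j) → Σ0 k f ≡ Σ0 k g
  Σ0-cong zero h = refl
  Σ0-cong (suc k) h = cong₂ _+_ (Σ0-cong k (λ j j<k → h j (NP.m<n⇒m<1+n j<k))) (h k (NP.n<1+n k))

  Π0-split : ∀ k l f → Π0 (k ℕ.+ l) f ≡ Π0 k f * Π0 l (λ j → f (k ℕ.+ j))
  Π0-split k zero f = trans (cong (λ v → Π0 v f) (NP.+-identityʳ k)) (sym (ℚP.*-identityʳ (Π0 k f)))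
  Π0-split k (suc l) f = begin
    Π0 (k ℕ.+ suc l) f ≡⟨ cong (λ v → Π0 v f) (NP.+-suc k l) ⟩
    Π0 (k ℕ.+ l) f * f (k ℕ.+ l) ≡⟨ cong (_* f (k ℕ.+ l)) (Π0-split k l f) ⟩
    Π0 k f * Π0 l (λ j → f (k ℕ.+ j)) * f (k ℕ.+ l) ≡⟨ ℚP.*-assoc (Π0 k f) (Π0 l (λ j → f (k ℕ.+ j))) (f (k ℕ.+ l)) ⟩
    Π0 k f * (Π0 l (λ j → f (k ℕ.+ j)) * f (k ℕ.+ l)) ∎

  Σ0-split : ∀ k l f → Σ0 (k ℕ.+ l) f ≡ Σ0 k f + Σ0 l (λ j → f (k ℕ.+ j))
  Σ0-split k zero f = trans (cong (λ v → Σ0 v f) (NP.+-identityʳ k)) (sym (ℚP.+-identityʳ (Σ0 k f)))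
  Σ0-split k (suc l) f = begin
    Σ0 (k ℕ.+ suc l) f ≡⟨ cong (λ v → Σ0 v f) (NP.+-suc k l) ⟩
    Σ0 (k ℕ.+ l) f + f (k ℕ.+ l) ≡⟨ cong (_+ f (k ℕ.+ l)) (Σ0-split k l f) ⟩
    Σ0 k f + Σ0 l (λ j → f (k ℕ.+ j)) + f (k ℕ.+ l) ≡⟨ ℚP.+-assoc (Σ0 k f) (Σ0 l (λ j → f (k ℕ.+ j))) (f (k ℕ.+ l)) ⟩
    Σ0 k f + (Σ0 l (λ j → f (k ℕ.+ j)) + f (k ℕ.+ l)) ∎

  Π0-first : ∀ k f → Π0 (suc k) f ≡ f 0 * Π0 k (λ j → f (suc j))
  Π0-first zero f = trans (ℚP.*-identityˡ (f 0)) (sym (ℚP.*-identityʳ (f 0)))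
  Π0-first (suc k) f = begin
    Π0 (suc k) f * f (suc k) ≡⟨ cong (_* f (suc k)) (Π0-first k f) ⟩
    f 0 * Π0 k (λ j → f (suc j)) * f (suc k) ≡⟨ ℚP.*-assoc (f 0) (Π0 k (λ j → f (suc j))) (f (suc k)) ⟩
    f 0 * (Π0 k (λ j → f (suc j)) * f (suc k)) ∎

  Σ0-first : ∀ k f → Σ0 (suc k) f ≡ f 0 + Σ0 k (λ j → f (suc j))
  Σ0-first zero f = trans (ℚP.+-identityˡ (f 0)) (sym (ℚP.+-identityʳ (f 0)))
  Σ0-first (suc k) f = begin
    Σ0 (suc k) f + f (suc k) ≡⟨ cong (_+ f (suc k)) (Σ0-first k f) ⟩
    f 0 + Σ0 k (λ j → f (suc j)) + f (suc k) ≡⟨ ℚP.+-assoc (f 0) (Σ0 k (λ j → f (suc j))) (f (suc k)) ⟩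
    f 0 + (Σ0 k (λ j → f (suc j)) + f (suc k)) ∎

  Π0-mul : ∀ k f g → Π0 k (λ j → f j * g j) ≡ Π0 k f * Π0 k g
  Π0-mul zero f g = refl
  Π0-mul (suc k) f g = begin
    Π0 k (λ j → f j * g j) * (f k * g k) ≡⟨ cong (_* (f k * g k)) (Π0-mul k f g) ⟩
    Π0 k f * Π0 k g * (f k * g k) ≡⟨ solve 4 (λ a b c d → a :* b :* (c :* d) := a :* c :* (b :* d)) refl (Π0 k f) (Π0 k g) (f k) (g k) ⟩
    Π0 k f * f k * (Π0 k g * g k) ∎

  Σ0-add : ∀ k f g → Σ0 k (λ j → f j + g j) ≡ Σ0 k f + Σ0 k g
  Σ0-add zero f g = refl
  Σ0-add (suc k) f g = begin
    Σ0 k (λ j → f j + g j) + (f k + g k) ≡⟨ cong (_+ (f k + g k)) (Σ0-add k f g) ⟩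
    Σ0 k f + Σ0 k g + (f k + g k) ≡⟨ solve 4 (λ a b c d → a :+ b :+ (c :+ d) := a :+ c :+ (b :+ d)) refl (Σ0 k f) (Σ0 k g) (f k) (g k) ⟩
    Σ0 k f + f k + (Σ0 k g + g k) ∎

  Σ0-scale : ∀ k c f → Σ0 k (λ j → c * f j) ≡ c * Σ0 k f
  Σ0-scale zero c f = sym (ℚP.*-zeroʳ c)
  Σ0-scale (suc k) c f = begin
    Σ0 k (λ j → c * f j) + c * f k ≡⟨ cong (_+ c * f k) (Σ0-scale k c f) ⟩
    c * Σ0 k f + c * f k ≡⟨ sym (ℚP.*-distribˡ-+ c (Σ0 k f) (f k)) ⟩
    c * (Σ0 k f + f k) ∎

  Π0-rev : ∀ k f → Π0 k (λ j → f (k ∸ suc j)) ≡ Π0 k f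
  Π0-rev zero f = refl
  Π0-rev (suc k) f = begin
    Π0 (suc k) (λ j → f (k ∸ j)) ≡⟨ Π0-first k (λ j → f (k ∸ j)) ⟩
    f k * Π0 k (λ j → f (k ∸ suc j)) ≡⟨ cong (f k *_) (Π0-rev k f) ⟩
    f k * Π0 k f ≡⟨ ℚP.*-comm (f k) (Π0 k f) ⟩
    Π0 k f * f k ∎

  Σ0-rev : ∀ k f → Σ0 k (λ j → f (k ∸ suc j)) ≡ Σ0 k f
  Σ0-rev zero f = refl
  Σ0-rev (suc k) f = begin
    Σ0 (suc k) (λ j → f (k ∸ j)) ≡⟨ Σ0-first k (λ j → f (k ∸ j)) ⟩
    f k + Σ0 k (λ j → f (k ∸ suc j)) ≡⟨ cong (f k +_) (Σ0-rev k f) ⟩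
    f k + Σ0 k f ≡⟨ ℚP.+-comm (f k) (Σ0 k f) ⟩
    Σ0 k f + f k ∎

  sumTo-Σ0 : ∀ n f → sumTo n f ≡ Σ0 (suc n) f
  sumTo-Σ0 zero f = sym (ℚP.+-identityˡ (f 0))
  sumTo-Σ0 (suc n) f = cong (_+ f (suc n)) (sumTo-Σ0 n f)

  H-Σ0 : ∀ n → H n ≡ Σ0 n (λ j → inv (ι (suc j)))
  H-Σ0 zero = refl
  H-Σ0 (suc n) = cong (_+ inv (ι (suc n))) (H-Σ0 n)

  Π-nz : ∀ k (f : ℕ → ℚ) → (∀ j → j < k → f j ≢ 0ℚ) → Π0 k f ≢ 0ℚ
  Π-nz zero f h ()
  Π-nz (suc k) f h = mul-nz (Π0 k f) (f k) (Π-nz k f (λ j j<k → h j (NP.m<n⇒m<1+n j<k))) (h k (NP.n<1+n k))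

  inv-Π : ∀ k (f : ℕ → ℚ) → (∀ j → j < k → f j ≢ 0ℚ) → inv (Π0 k f) ≡ Π0 k (λ j → inv (f j))
  inv-Π zero f h = refl
  inv-Π (suc k) f h = trans (inv-* (Π0 k f) (f k) (Π-nz k f (λ j j<k → h j (NP.m<n⇒m<1+n j<k))) (h k (NP.n<1+n k)))
    (cong (_* inv (f k)) (inv-Π k f (λ j j<k → h j (NP.m<n⇒m<1+n j<k))))

  sq-Π : ∀ k (f : ℕ → ℚ) → sq (Π0 k f) ≡ Π0 k (λ j → sq (f j))
  sq-Π k f = sym (Π0-mul k f f)

  Σ0-zero : ∀ k → Σ0 k (λ _ → 0ℚ) ≡ 0ℚ
  Σ0-zero zero = refl
  Σ0-zero (suc k) = trans (ℚP.+-identityʳ _) (Σ0-zero k)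


-- ℤ_p inside ℚ.  `Z x` says x = a/d with p ∤ d, `Un x` that x is a p-adic
-- unit (p ∤ a, p ∤ d); both are witnessed by an explicit fraction so that ring
-- operations can be handled on numerators and denominators.
module PIntegers (p : ℕ) (pr : Prime p) where
  open import Data.Nat.Primality using (euclidsLemma; prime⇒nonTrivial)
  open import Data.Integer as ℤ using (ℤ; +_)
  import Data.Integer.Properties as ℤP
  open import Data.Integer.Divisibility.Signed as S using (divides)
  import Data.Nat.Divisibility as ND
  import Data.Nat.Properties as NP
  open import Data.Rational as ℚ using (mkℚ; toℚᵘ)
  import Data.Rational.Properties as ℚP
  import Data.Rational.Unnormalised as U
  import Data.Rational.Unnormalised.Properties as UP
  import Data.Nat.Coprimality as Cop
  open import Relation.Binary.PropositionalEquality
  open import Relation.Nullary using (yes; no)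
  open import Relation.Nullary.Decidable using (recompute)
  open import Data.Empty using (⊥-elim)
  open import Data.Sum using (inj₁; inj₂)
  open import Data.Rational.Solver using (module +-*-Solver)
  open +-*-Solver
  open RationalField
  open ≡-Reasoning

  P : ℚ
  P = ι p

  instance
    pNT : ℕ.NonTrivial p
    pNT = prime⇒nonTrivial pr

  p>1 : 1 ℕ.< p
  p>1 = ℕ.nonTrivial⇒n>1 p

  Unitℤ : ℤ → Set
  Unitℤ z = ¬ ((+ p) S.∣ z)

  record Z (x : ℚ) : Set where
    constructor mkZ
    field
      za : ℤ
      zd : ℤ
      znd : Unitℤ zd
      zeq : x * embedℤ zd ≡ embedℤ za

  record Un (x : ℚ) : Set where
    constructor mkU
    field
      ua : ℤ
      ud : ℤ
      una : Unitℤ ua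
      und : Unitℤ ud
      ueq : x * embedℤ ud ≡ embedℤ ua

  record ModP (x y : ℚ) : Set where
    constructor mkModP
    field
      w1 : ℚ
      zw1 : Z w1
      eq1 : x ≡ y + P * w1

  record ModP² (x y : ℚ) : Set where
    constructor mkModP²
    field
      w2 : ℚ
      zw2 : Z w2
      eq2 : x ≡ y + P * P * w2

  Unitℤ-* : ∀ a b → Unitℤ a → Unitℤ b → Unitℤ (a ℤ.* b)
  Unitℤ-* a b na nb d with S.∣⇒∣ᵤ d
  ... | du rewrite ℤP.abs-* a b with euclidsLemma (ℤ.∣ a ∣) (ℤ.∣ b ∣) pr du
  ... | inj₁ x = na (S.∣ᵤ⇒∣ x)
  ... | inj₂ y = nb (S.∣ᵤ⇒∣ y)

  Unitℤ-ι : ∀ j → 0 ℕ.< j → j ℕ.< p → Unitℤ (+ j)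
  Unitℤ-ι (suc j) _ j<p d = NP.<⇒≱ j<p (ND.∣⇒≤ (S.∣⇒∣ᵤ d))

  Unitℤ-1 : Unitℤ (+ 1)
  Unitℤ-1 = Unitℤ-ι 1 (s≤s z≤n) p>1

  Unitℤ-neg : ∀ a → Unitℤ a → Unitℤ (ℤ.- a)
  Unitℤ-neg a na d = na (subst ((+ p) S.∣_) (ℤP.neg-involutive a) (S.∣m⇒∣-m d))

  Unitℤ-+p : ∀ a y → Unitℤ a → Unitℤ (a ℤ.+ y ℤ.* + p)
  Unitℤ-+p a y na d = na (S.∣m+n∣n⇒∣m d (S.∣n⇒∣m*n y S.∣-refl))

  Unitℤ-nz : ∀ d → Unitℤ d → embedℤ d ≢ 0ℚ
  Unitℤ-nz d nd e with ℚP.p≡0⇒↥p≡0 _ e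
  ... | r rewrite embedℤ-mk d = nd (subst ((+ p) S.∣_) (sym r) (divides (+ 0) refl))

  Z-embedℤ : ∀ a → Z (embedℤ a)
  Z-embedℤ a = mkZ a (+ 1) Unitℤ-1 (ℚP.*-identityʳ (embedℤ a))

  Z-ι : ∀ n → Z (ι n)
  Z-ι n = Z-embedℤ (+ n)

  Z-0 : Z 0ℚ
  Z-0 = Z-ι 0

  Z-1 : Z 1ℚ
  Z-1 = Z-ι 1

  Z-P : Z P
  Z-P = Z-ι p

  eq-+ : ∀ x y a d a' d' → x * embedℤ d ≡ embedℤ a → y * embedℤ d' ≡ embedℤ a' →
         (x + y) * embedℤ (d ℤ.* d') ≡ embedℤ (a ℤ.* d' ℤ.+ a' ℤ.* d)
  eq-+ x y a d a' d' e e' = begin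
      (x + y) * embedℤ (d ℤ.* d') ≡⟨ cong ((x + y) *_) (embedℤ-* d d') ⟩
      (x + y) * (embedℤ d * embedℤ d') ≡⟨ solve 4 (λ x y D D' → (x :+ y) :* (D :* D') := (x :* D) :* D' :+ (y :* D') :* D) refl x y (embedℤ d) (embedℤ d') ⟩
      (x * embedℤ d) * embedℤ d' + (y * embedℤ d') * embedℤ d ≡⟨ cong₂ (λ u v → u * embedℤ d' + v * embedℤ d) e e' ⟩
      embedℤ a * embedℤ d' + embedℤ a' * embedℤ d ≡⟨ sym (cong₂ _+_ (embedℤ-* a d') (embedℤ-* a' d)) ⟩
      embedℤ (a ℤ.* d') + embedℤ (a' ℤ.* d) ≡⟨ sym (embedℤ-+ (a ℤ.* d') (a' ℤ.* d)) ⟩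
      embedℤ (a ℤ.* d' ℤ.+ a' ℤ.* d) ∎

  eq-* : ∀ x y a d a' d' → x * embedℤ d ≡ embedℤ a → y * embedℤ d' ≡ embedℤ a' →
         (x * y) * embedℤ (d ℤ.* d') ≡ embedℤ (a ℤ.* a')
  eq-* x y a d a' d' e e' = begin
      (x * y) * embedℤ (d ℤ.* d') ≡⟨ cong ((x * y) *_) (embedℤ-* d d') ⟩
      (x * y) * (embedℤ d * embedℤ d') ≡⟨ solve 4 (λ x y D D' → (x :* y) :* (D :* D') := (x :* D) :* (y :* D')) refl x y (embedℤ d) (embedℤ d') ⟩
      (x * embedℤ d) * (y * embedℤ d') ≡⟨ cong₂ _*_ e e' ⟩
      embedℤ a * embedℤ a' ≡⟨ sym (embedℤ-* a a') ⟩
      embedℤ (a ℤ.* a') ∎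

  eq-neg : ∀ x a d → x * embedℤ d ≡ embedℤ a → (- x) * embedℤ d ≡ embedℤ (ℤ.- a)
  eq-neg x a d e = begin
      (- x) * embedℤ d ≡⟨ sym (ℚP.neg-distribˡ-* x (embedℤ d)) ⟩
      - (x * embedℤ d) ≡⟨ cong -_ e ⟩
      - embedℤ a ≡⟨ sym (embedℤ-neg a) ⟩
      embedℤ (ℤ.- a) ∎

  Z-+ : ∀ {x y} → Z x → Z y → Z (x + y)
  Z-+ {x} {y} (mkZ a d nd e) (mkZ a' d' nd' e') =
    mkZ (a ℤ.* d' ℤ.+ a' ℤ.* d) (d ℤ.* d') (Unitℤ-* d d' nd nd') (eq-+ x y a d a' d' e e')

  Z-* : ∀ {x y} → Z x → Z y → Z (x * y)
  Z-* {x} {y} (mkZ a d nd e) (mkZ a' d' nd' e') =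
    mkZ (a ℤ.* a') (d ℤ.* d') (Unitℤ-* d d' nd nd') (eq-* x y a d a' d' e e')

  Z-neg : ∀ {x} → Z x → Z (- x)
  Z-neg {x} (mkZ a d nd e) = mkZ (ℤ.- a) d nd (eq-neg x a d e)

  Z-- : ∀ {x y} → Z x → Z y → Z (x - y)
  Z-- {x} {y} zx zy = Z-+ {x} { - y} zx (Z-neg {y} zy)

  Z-≡ : ∀ {x y} → x ≡ y → Z x → Z y
  Z-≡ refl z = z

  Un⇒Z : ∀ {x} → Un x → Z x
  Un⇒Z (mkU a d na nd e) = mkZ a d nd e

  Un-nz : ∀ {x} → Un x → x ≢ 0ℚ
  Un-nz {x} (mkU a d na nd e) x0 = Unitℤ-nz a na (trans (sym e) (trans (cong (_* embedℤ d) x0) (ℚP.*-zeroˡ (embedℤ d))))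

  Un-inv : ∀ {x} → Un x → Un (inv x)
  Un-inv {x} u@(mkU a d na nd e) = mkU d a nd na (begin
      inv x * embedℤ a ≡⟨ cong (inv x *_) (sym e) ⟩
      inv x * (x * embedℤ d) ≡⟨ sym (ℚP.*-assoc (inv x) x (embedℤ d)) ⟩
      inv x * x * embedℤ d ≡⟨ cong (_* embedℤ d) (inv-l x (Un-nz u)) ⟩
      1ℚ * embedℤ d ≡⟨ ℚP.*-identityˡ (embedℤ d) ⟩
      embedℤ d ∎)

  Z-inv : ∀ {x} → Un x → Z (inv x)
  Z-inv {x} u = Un⇒Z {inv x} (Un-inv {x} u)

  Un-* : ∀ {x y} → Un x → Un y → Un (x * y)
  Un-* {x} {y} (mkU a d na nd e) (mkU a' d' na' nd' e') =
    mkU (a ℤ.* a') (d ℤ.* d') (Unitℤ-* a a' na na') (Unitℤ-* d d' nd nd') (eq-* x y a d a' d' e e')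

  Un-neg : ∀ {x} → Un x → Un (- x)
  Un-neg {x} (mkU a d na nd e) = mkU (ℤ.- a) d (Unitℤ-neg a na) nd (eq-neg x a d e)

  Un-ι : ∀ j → 0 ℕ.< j → j ℕ.< p → Un (ι j)
  Un-ι j 0<j j<p = mkU (+ j) (+ 1) (Unitℤ-ι j 0<j j<p) Unitℤ-1 (ℚP.*-identityʳ (ι j))

  Un-1 : Un 1ℚ
  Un-1 = Un-ι 1 (s≤s z≤n) p>1

  Un-≡ : ∀ {x y} → x ≡ y → Un x → Un y
  Un-≡ refl z = z

  Un-lift : ∀ {u e} → Un u → Z e → Un (u + P * e)
  Un-lift {u} {e} (mkU a d na nd eq) (mkZ a' d' nd' eq') =
    mkU (a ℤ.* d' ℤ.+ (a' ℤ.* d) ℤ.* + p) (d ℤ.* d') (Unitℤ-+p (a ℤ.* d') (a' ℤ.* d) (Unitℤ-* a d' na nd')) (Unitℤ-* d d' nd nd') (begin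
      (u + P * e) * embedℤ (d ℤ.* d') ≡⟨ cong ((u + P * e) *_) (embedℤ-* d d') ⟩
      (u + P * e) * (embedℤ d * embedℤ d') ≡⟨ solve 5 (λ u e P D D' → (u :+ P :* e) :* (D :* D') := (u :* D) :* D' :+ ((e :* D') :* D) :* P) refl u e P (embedℤ d) (embedℤ d') ⟩
      (u * embedℤ d) * embedℤ d' + ((e * embedℤ d') * embedℤ d) * P ≡⟨ cong₂ (λ x y → x * embedℤ d' + (y * embedℤ d) * P) eq eq' ⟩
      embedℤ a * embedℤ d' + (embedℤ a' * embedℤ d) * embedℤ (+ p) ≡⟨ sym (cong₂ _+_ (embedℤ-* a d') (trans (embedℤ-* (a' ℤ.* d) (+ p)) (cong (_* embedℤ (+ p)) (embedℤ-* a' d)))) ⟩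
      embedℤ (a ℤ.* d') + embedℤ ((a' ℤ.* d) ℤ.* + p) ≡⟨ sym (embedℤ-+ (a ℤ.* d') ((a' ℤ.* d) ℤ.* + p)) ⟩
      embedℤ (a ℤ.* d' ℤ.+ (a' ℤ.* d) ℤ.* + p) ∎)

  Z-unit : ∀ {x} → Z x → ¬ ModP x 0ℚ → Un x
  Z-unit {x} (mkZ a d nd e) ne with (+ p) S.∣? a
  ... | no na = mkU a d na nd e
  ... | yes (divides q aeq) = ⊥-elim (ne (mkModP (embedℤ q * inv (embedℤ d)) zz xeq))
    where
    dnz : embedℤ d ≢ 0ℚ
    dnz = Unitℤ-nz d nd
    zz : Z (embedℤ q * inv (embedℤ d))
    zz = mkZ q d nd div-eq-inv
      where
      div-eq-inv : embedℤ q * inv (embedℤ d) * embedℤ d ≡ embedℤ q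
      div-eq-inv = trans (ℚP.*-assoc (embedℤ q) (inv (embedℤ d)) (embedℤ d)) (trans (cong (embedℤ q *_) (inv-l (embedℤ d) dnz)) (ℚP.*-identityʳ (embedℤ q)))
    xeq : x ≡ 0ℚ + P * (embedℤ q * inv (embedℤ d))
    xeq = begin
      x ≡⟨ sym (div-eq (x * embedℤ d) x (embedℤ d) dnz refl) ⟩
      x * embedℤ d * inv (embedℤ d) ≡⟨ cong (λ v → v * inv (embedℤ d)) (trans e (trans (cong embedℤ aeq) (embedℤ-* q (+ p)))) ⟩
      embedℤ q * P * inv (embedℤ d) ≡⟨ solve 3 (λ q P i → q :* P :* i := con 0ℚ :+ P :* (q :* i)) refl (embedℤ q) P (inv (embedℤ d)) ⟩
      0ℚ + P * (embedℤ q * inv (embedℤ d)) ∎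

  -- Agreement with the notion InZp: the reduced denominator divides any
  -- denominator witness, and conversely the reduced fraction is a witness.
  toℚᵘ-embedℤ : ∀ z → toℚᵘ (embedℤ z) ≡ U.mkℚᵘ z 0
  toℚᵘ-embedℤ z = cong toℚᵘ (embedℤ-mk z)

  Z⇒InZp : ∀ {x} → Z x → InZp p x
  Z⇒InZp {mkℚ n dd c} (mkZ a d nd e) p∣den = nd (S.∣ᵤ⇒∣ (ND.∣-trans p∣den den∣d))
    where
    x : ℚ
    x = mkℚ n dd c
    equ : U.mkℚᵘ n dd U.* U.mkℚᵘ d 0 U.≃ U.mkℚᵘ a 0
    equ = UP.≃-trans (UP.≃-sym (ℚP.toℚᵘ-homo-* x (mkℚ d 0 (Cop.sym (Cop.1-coprimeTo _)))))
            (UP.≃-reflexive (trans (cong toℚᵘ (cong (x *_) (sym (embedℤ-mk d)))) (trans (cong toℚᵘ e) (toℚᵘ-embedℤ a))))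
    zeq : n ℤ.* d ≡ a ℤ.* + suc dd
    zeq with equ
    ... | U.*≡* q = trans (sym (ℤP.*-identityʳ _)) (trans q (cong (λ v → a ℤ.* + v) (NP.*-identityʳ (suc dd))))
    neq : ℤ.∣ n ∣ ℕ.* ℤ.∣ d ∣ ≡ ℤ.∣ a ∣ ℕ.* suc dd
    neq = trans (sym (ℤP.abs-* n d)) (trans (cong ℤ.∣_∣ zeq) (ℤP.abs-* a (+ suc dd)))
    den∣d : suc dd ND.∣ ℤ.∣ d ∣
    den∣d = Cop.coprime-divisor (Cop.sym (recompute (Cop.coprime? _ _) c)) (ND.divides ℤ.∣ a ∣ neq)

  InZp⇒Z : ∀ {x} → InZp p x → Z x
  InZp⇒Z {mkℚ n dd c} np = mkZ n (+ suc dd) (λ d → np (S.∣⇒∣ᵤ d)) (ℚP.toℚᵘ-injective equ)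
    where
    x : ℚ
    x = mkℚ n dd c
    equ : toℚᵘ (x * embedℤ (+ suc dd)) U.≃ toℚᵘ (embedℤ n)
    equ = UP.≃-trans (ℚP.toℚᵘ-homo-* x (embedℤ (+ suc dd)))
          (UP.≃-trans (UP.≃-reflexive (cong (λ v → U.mkℚᵘ n dd U.* v) (toℚᵘ-embedℤ (+ suc dd))))
          (UP.≃-trans (U.*≡* (trans (ℤP.*-identityʳ _) (cong (λ v → n ℤ.* + v) (sym (NP.*-identityʳ (suc dd))))))
            (UP.≃-reflexive (sym (toℚᵘ-embedℤ n)))))


module Congruences (p : ℕ) (pr : Prime p) where
  import Data.Rational.Properties as ℚP
  import Data.Nat.Properties as NP
  open import Relation.Binary.PropositionalEquality
  open import Data.Rational.Solver using (module +-*-Solver)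
  open +-*-Solver
  open ≡-Reasoning
  open RationalField
  open PIntegers p pr

  P≢0 : P ≢ 0ℚ
  P≢0 = ιpos-nz p (NP.<-trans (s≤s z≤n) p>1)

  ModP²-≡ : ∀ {x y} → x ≡ y → ModP² x y
  ModP²-≡ {x} {y} e = mkModP² (0ℚ) (Z-0) (trans e (solve 2 (λ y P → y := y :+ P :* P :* con 0ℚ) refl y P))

  ModP²-refl : ∀ {x} → ModP² x x
  ModP²-refl = ModP²-≡ refl

  ModP²-sym : ∀ {x y} → ModP² x y → ModP² y x
  ModP²-sym {x} {y} (mkModP² z zz e) = mkModP² (- z) (Z-neg {z} zz) (begin
    y ≡⟨ solve 3 (λ y P z → y := (y :+ P :* P :* z) :+ P :* P :* (:- z)) refl y P z ⟩
    (y + P * P * z) + P * P * (- z) ≡⟨ cong (λ v → v + P * P * (- z)) (sym e) ⟩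
    x + P * P * (- z) ∎)

  ModP²-trans : ∀ {x y w} → ModP² x y → ModP² y w → ModP² x w
  ModP²-trans {x} {y} {w} (mkModP² z zz e) (mkModP² z' zz' e') = mkModP² (z' + z) (Z-+ {z'} {z} zz' zz) (begin
    x ≡⟨ e ⟩
    y + P * P * z ≡⟨ cong (λ v → v + P * P * z) e' ⟩
    w + P * P * z' + P * P * z ≡⟨ solve 4 (λ w P z z' → w :+ P :* P :* z' :+ P :* P :* z := w :+ P :* P :* (z' :+ z)) refl w P z z' ⟩
    w + P * P * (z' + z) ∎)

  ModP²-+ : ∀ {x y x' y'} → ModP² x y → ModP² x' y' → ModP² (x + x') (y + y')
  ModP²-+ {x} {y} {x'} {y'} (mkModP² z zz e) (mkModP² z' zz' e') = mkModP² (z + z') (Z-+ {z} {z'} zz zz') (begin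
    x + x' ≡⟨ cong₂ _+_ e e' ⟩
    (y + P * P * z) + (y' + P * P * z') ≡⟨ solve 5 (λ y y' P z z' → (y :+ P :* P :* z) :+ (y' :+ P :* P :* z') := (y :+ y') :+ P :* P :* (z :+ z')) refl y y' P z z' ⟩
    y + y' + P * P * (z + z') ∎)

  ModP²-*Z : ∀ {w x y} → Z w → ModP² x y → ModP² (w * x) (w * y)
  ModP²-*Z {w} {x} {y} zw (mkModP² z zz e) = mkModP² (w * z) (Z-* {w} {z} zw zz) (begin
    w * x ≡⟨ cong (w *_) e ⟩
    w * (y + P * P * z) ≡⟨ solve 4 (λ w y P z → w :* (y :+ P :* P :* z) := w :* y :+ P :* P :* (w :* z)) refl w y P z ⟩
    w * y + P * P * (w * z) ∎)

  ModP²-*Zʳ : ∀ {w x y} → Z w → ModP² x y → ModP² (x * w) (y * w)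
  ModP²-*Zʳ {w} {x} {y} zw e = ModP²-trans (ModP²-≡ (ℚP.*-comm x w)) (ModP²-trans (ModP²-*Z {w} zw e) (ModP²-≡ (ℚP.*-comm w y)))

  ModP²-Z : ∀ {x y} → ModP² x y → Z y → Z x
  ModP²-Z {x} {y} (mkModP² z zz e) zy = Z-≡ (sym e) (Z-+ {y} {P * P * z} zy (Z-* {P * P} {z} (Z-* {P} {P} Z-P Z-P) zz))

  ModP²-mul : ∀ {x y x' y'} → Z x → Z y' → ModP² x y → ModP² x' y' → ModP² (x * x') (y * y')
  ModP²-mul {x} {y} {x'} {y'} zx zy' e e' = ModP²-trans (ModP²-*Z {x} zx e') (ModP²-*Zʳ {y'} zy' e)

  ModP-≡ : ∀ {x y} → x ≡ y → ModP x y
  ModP-≡ {x} {y} e = mkModP (0ℚ) (Z-0) (trans e (solve 2 (λ y P → y := y :+ P :* con 0ℚ) refl y P))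

  ModP-refl : ∀ {x} → ModP x x
  ModP-refl = ModP-≡ refl

  ModP-sym : ∀ {x y} → ModP x y → ModP y x
  ModP-sym {x} {y} (mkModP z zz e) = mkModP (- z) (Z-neg {z} zz) (begin
    y ≡⟨ solve 3 (λ y P z → y := (y :+ P :* z) :+ P :* (:- z)) refl y P z ⟩
    (y + P * z) + P * (- z) ≡⟨ cong (λ v → v + P * (- z)) (sym e) ⟩
    x + P * (- z) ∎)

  ModP-trans : ∀ {x y w} → ModP x y → ModP y w → ModP x w
  ModP-trans {x} {y} {w} (mkModP z zz e) (mkModP z' zz' e') = mkModP (z' + z) (Z-+ {z'} {z} zz' zz) (begin
    x ≡⟨ e ⟩
    y + P * z ≡⟨ cong (λ v → v + P * z) e' ⟩
    w + P * z' + P * z ≡⟨ solve 4 (λ w P z z' → w :+ P :* z' :+ P :* z := w :+ P :* (z' :+ z)) refl w P z z' ⟩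
    w + P * (z' + z) ∎)

  ModP-+ : ∀ {x y x' y'} → ModP x y → ModP x' y' → ModP (x + x') (y + y')
  ModP-+ {x} {y} {x'} {y'} (mkModP z zz e) (mkModP z' zz' e') = mkModP (z + z') (Z-+ {z} {z'} zz zz') (begin
    x + x' ≡⟨ cong₂ _+_ e e' ⟩
    (y + P * z) + (y' + P * z') ≡⟨ solve 5 (λ y y' P z z' → (y :+ P :* z) :+ (y' :+ P :* z') := (y :+ y') :+ P :* (z :+ z')) refl y y' P z z' ⟩
    y + y' + P * (z + z') ∎)

  ModP-neg : ∀ {x y} → ModP x y → ModP (- x) (- y)
  ModP-neg {x} {y} (mkModP z zz e) = mkModP (- z) (Z-neg {z} zz) (begin
    - x ≡⟨ cong -_ e ⟩
    - (y + P * z) ≡⟨ solve 3 (λ y P z → :- (y :+ P :* z) := (:- y) :+ P :* (:- z)) refl y P z ⟩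
    - y + P * (- z) ∎)

  ModP-*Z : ∀ {w x y} → Z w → ModP x y → ModP (w * x) (w * y)
  ModP-*Z {w} {x} {y} zw (mkModP z zz e) = mkModP (w * z) (Z-* {w} {z} zw zz) (begin
    w * x ≡⟨ cong (w *_) e ⟩
    w * (y + P * z) ≡⟨ solve 4 (λ w y P z → w :* (y :+ P :* z) := w :* y :+ P :* (w :* z)) refl w y P z ⟩
    w * y + P * (w * z) ∎)

  ModP-Z : ∀ {x y} → ModP x y → Z y → Z x
  ModP-Z {x} {y} (mkModP z zz e) zy = Z-≡ (sym e) (Z-+ {y} {P * z} zy (Z-* {P} {z} Z-P zz))

  cancel-P : ∀ {x y} → ModP² (P * x) (P * y) → ModP x y
  cancel-P {x} {y} (mkModP² z zz e) = mkModP (z) (zz) (begin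
    x ≡⟨ sym (div-eq (P * x) x P P≢0 (ℚP.*-comm P x)) ⟩
    P * x * inv P ≡⟨ cong (_* inv P) e ⟩
    (P * y + P * P * z) * inv P ≡⟨ solve 4 (λ P y z i → (P :* y :+ P :* P :* z) :* i := (y :+ P :* z) :* (P :* i)) refl P y z (inv P) ⟩
    (y + P * z) * (P * inv P) ≡⟨ cong ((y + P * z) *_) (inv-r P P≢0) ⟩
    (y + P * z) * 1ℚ ≡⟨ ℚP.*-identityʳ _ ⟩
    y + P * z ∎)

  ModP-inv : ∀ {x y} → Un x → Un y → ModP x y → ModP (inv x) (inv y)
  ModP-inv {x} {y} ux uy (mkModP z zz e) = mkModP (- (z * inv x * inv y)) (Z-neg {z * inv x * inv y} (Z-* {z * inv x} {inv y} (Z-* {z} {inv x} zz (Z-inv {x} ux)) (Z-inv {y} uy))) (begin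
    inv x ≡⟨ sym (ℚP.*-identityʳ (inv x)) ⟩
    inv x * 1ℚ ≡⟨ cong (inv x *_) (sym (inv-r y (Un-nz {y} uy))) ⟩
    inv x * (y * inv y) ≡⟨ cong (λ v → inv x * (v * inv y)) ye ⟩
    inv x * ((x + P * (- z)) * inv y) ≡⟨ solve 5 (λ ix x P z iy → ix :* ((x :+ P :* (:- z)) :* iy) := iy :* (ix :* x) :+ P :* (:- (z :* ix :* iy))) refl (inv x) x P z (inv y) ⟩
    inv y * (inv x * x) + P * - (z * inv x * inv y) ≡⟨ cong (λ v → inv y * v + P * - (z * inv x * inv y)) (inv-l x (Un-nz {x} ux)) ⟩
    inv y * 1ℚ + P * - (z * inv x * inv y) ≡⟨ cong (_+ P * - (z * inv x * inv y)) (ℚP.*-identityʳ (inv y)) ⟩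
    inv y + P * - (z * inv x * inv y) ∎)
    where
    ye : y ≡ x + P * (- z)
    ye = trans (solve 3 (λ y P z → y := (y :+ P :* z) :+ P :* (:- z)) refl y P z) (cong (λ v → v + P * (- z)) (sym e))


-- First-order p-adic expansions.  `Ex X A S` says X ≡ A·(1 + p·S) (mod p²); these
-- multiply by adding the S's, invert by negating S, and a product of factors
-- u_j + p·e_j expands with S = Σ e_j / u_j.
module Expansions (p : ℕ) (pr : Prime p) where
  import Data.Rational.Properties as ℚP
  import Data.Nat.Properties as NP
  open import Relation.Binary.PropositionalEquality
  open import Data.Rational.Solver using (module +-*-Solver)
  open +-*-Solver
  open ≡-Reasoning
  open RationalField
  open IteratedOps
  open PIntegers p pr
  open Congruences p pr

  Ex : ℚ → ℚ → ℚ → Set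
  Ex X A S = ModP² X (A * (1ℚ + P * S))

  Z-1PS : ∀ {S} → Z S → Z (1ℚ + P * S)
  Z-1PS {S} zS = Z-+ {1ℚ} {P * S} Z-1 (Z-* {P} {S} Z-P zS)

  Un-1PS : ∀ {S} → Z S → Un (1ℚ + P * S)
  Un-1PS {S} zS = Un-lift {1ℚ} {S} Un-1 zS

  Ex-Z : ∀ {X A S} → Z A → Z S → Ex X A S → Z X
  Ex-Z {X} {A} {S} zA zS e = ModP²-Z e (Z-* {A} {1ℚ + P * S} zA (Z-1PS {S} zS))

  Un-A1PS : ∀ {A S} → Un A → Z S → Un (A * (1ℚ + P * S))
  Un-A1PS {A} {S} uA zS = Un-* {A} {1ℚ + P * S} uA (Un-1PS {S} zS)

  ModP²-Un : ∀ {x y} → ModP² x y → Un y → Un x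
  ModP²-Un {x} {y} (mkModP² z zz e) uy = Un-≡ (sym (trans e (solve 3 (λ y P z → y :+ P :* P :* z := y :+ P :* (P :* z)) refl y P z))) (Un-lift {y} {P * z} uy (Z-* {P} {z} Z-P zz))

  Ex-Un : ∀ {X A S} → Un A → Z S → Ex X A S → Un X
  Ex-Un {X} {A} {S} uA zS e = ModP²-Un e (Un-A1PS {A} {S} uA zS)

  Ex-refl : ∀ {A} → Ex A A 0ℚ
  Ex-refl {A} = ModP²-≡ (solve 2 (λ A P → A := A :* (con 1ℚ :+ P :* con 0ℚ)) refl A P)

  Ex-mul : ∀ {X Y A B S T} → Z A → Z B → Z S → Z T → Ex X A S → Ex Y B T → Ex (X * Y) (A * B) (S + T)
  Ex-mul {X} {Y} {A} {B} {S} {T} zA zB zS zT ex ey =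
    ModP²-trans (ModP²-mul {X} {A * (1ℚ + P * S)} {Y} {B * (1ℚ + P * T)} (Ex-Z {X} {A} {S} zA zS ex) (Z-* {B} {1ℚ + P * T} zB (Z-1PS {T} zT)) ex ey)
    (mkModP² (A * B * S * T) (Z-* {A * B * S} {T} (Z-* {A * B} {S} (Z-* {A} {B} zA zB) zS) zT)
      (solve 5 (λ A B S T P → A :* (con 1ℚ :+ P :* S) :* (B :* (con 1ℚ :+ P :* T)) := A :* B :* (con 1ℚ :+ P :* (S :+ T)) :+ P :* P :* (A :* B :* S :* T)) refl A B S T P))

  Ex-lin : ∀ {u e} → Un u → Z e → Ex (u + P * e) u (e * inv u)
  Ex-lin {u} {e} uu ze = ModP²-≡ (begin
    u + P * e ≡⟨ cong (u +_) (sym (ℚP.*-identityʳ (P * e))) ⟩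
    u + P * e * 1ℚ ≡⟨ cong (λ v → u + P * e * v) (sym (inv-r u (Un-nz {u} uu))) ⟩
    u + P * e * (u * inv u) ≡⟨ solve 4 (λ u e P i → u :+ P :* e :* (u :* i) := u :* (con 1ℚ :+ P :* (e :* i))) refl u e P (inv u) ⟩
    u * (1ℚ + P * (e * inv u)) ∎)

  ModP²-inv : ∀ {x y} → Un x → Un y → ModP² x y → ModP² (inv x) (inv y)
  ModP²-inv {x} {y} ux uy (mkModP² z zz e) = mkModP² (- (z * inv x * inv y)) (Z-neg {z * inv x * inv y} (Z-* {z * inv x} {inv y} (Z-* {z} {inv x} zz (Z-inv {x} ux)) (Z-inv {y} uy))) (begin
    inv x ≡⟨ sym (ℚP.*-identityʳ (inv x)) ⟩
    inv x * 1ℚ ≡⟨ cong (inv x *_) (sym (inv-r y (Un-nz {y} uy))) ⟩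
    inv x * (y * inv y) ≡⟨ cong (λ v → inv x * (v * inv y)) ye ⟩
    inv x * ((x + P * P * (- z)) * inv y) ≡⟨ solve 5 (λ ix x P z iy → ix :* ((x :+ P :* P :* (:- z)) :* iy) := iy :* (ix :* x) :+ P :* P :* (:- (z :* ix :* iy))) refl (inv x) x P z (inv y) ⟩
    inv y * (inv x * x) + P * P * - (z * inv x * inv y) ≡⟨ cong (λ v → inv y * v + P * P * - (z * inv x * inv y)) (inv-l x (Un-nz {x} ux)) ⟩
    inv y * 1ℚ + P * P * - (z * inv x * inv y) ≡⟨ cong (_+ P * P * - (z * inv x * inv y)) (ℚP.*-identityʳ (inv y)) ⟩
    inv y + P * P * - (z * inv x * inv y) ∎)
    where
    ye : y ≡ x + P * P * (- z)
    ye = trans (solve 3 (λ y P z → y := (y :+ P :* P :* z) :+ P :* P :* (:- z)) refl y P z) (cong (λ v → v + P * P * (- z)) (sym e))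

  inv-1PS : ∀ {S} → Z S → ModP² (inv (1ℚ + P * S)) (1ℚ + P * (- S))
  inv-1PS {S} zS = ModP²-sym (mkModP² (- (inv V * S * S)) (Z-neg {inv V * S * S} (Z-* {inv V * S} {S} (Z-* {inv V} {S} (Z-inv {V} uV) zS) zS)) (begin
    1ℚ + P * (- S) ≡⟨ sym (div-eq' ) ⟩
    inv V * (V * (1ℚ + P * (- S))) ≡⟨ solve 3 (λ i P S → i :* ((con 1ℚ :+ P :* S) :* (con 1ℚ :+ P :* (:- S))) := i :+ P :* P :* (:- (i :* S :* S))) refl (inv V) P S ⟩
    inv V + P * P * - (inv V * S * S) ∎))
    where
    V : ℚ
    V = 1ℚ + P * S
    uV : Un V
    uV = Un-1PS {S} zS
    div-eq' : inv V * (V * (1ℚ + P * (- S))) ≡ 1ℚ + P * (- S)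
    div-eq' = trans (sym (ℚP.*-assoc (inv V) V (1ℚ + P * (- S)))) (trans (cong (_* (1ℚ + P * (- S))) (inv-l V (Un-nz {V} uV))) (ℚP.*-identityˡ _))

  Ex-inv : ∀ {X A S} → Un A → Z S → Ex X A S → Ex (inv X) (inv A) (- S)
  Ex-inv {X} {A} {S} uA zS ex =
    ModP²-trans (ModP²-inv {X} {A * V} (Ex-Un {X} {A} {S} uA zS ex) (Un-A1PS {A} {S} uA zS) ex)
    (ModP²-trans (ModP²-≡ (inv-* A V (Un-nz {A} uA) (Un-nz {V} (Un-1PS {S} zS))))
       (ModP²-*Z {inv A} (Z-inv {A} uA) (inv-1PS {S} zS)))
    where V = 1ℚ + P * S

  Ex-shift : ∀ {X A S S'} → Z A → ModP S S' → Ex X A S → Ex X A S'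
  Ex-shift {X} {A} {S} {S'} zA (mkModP w zw e) ex = ModP²-trans ex (mkModP² (A * w) (Z-* {A} {w} zA zw) (begin
    A * (1ℚ + P * S) ≡⟨ cong (λ v → A * (1ℚ + P * v)) e ⟩
    A * (1ℚ + P * (S' + P * w)) ≡⟨ solve 4 (λ A P S w → A :* (con 1ℚ :+ P :* (S :+ P :* w)) := A :* (con 1ℚ :+ P :* S) :+ P :* P :* (A :* w)) refl A P S' w ⟩
    A * (1ℚ + P * S') + P * P * (A * w) ∎))

  Ex-base : ∀ {X A A' S} → Z S → ModP² A A' → Ex X A S → Ex X A' S
  Ex-base {X} {A} {A'} {S} zS eA ex = ModP²-trans ex (ModP²-*Zʳ {1ℚ + P * S} (Z-1PS {S} zS) eA)

  Ex-back : ∀ {X A S} → Z A → Z S → Ex X A S → Ex A X (- S)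
  Ex-back {X} {A} {S} zA zS ex = ModP²-sym (ModP²-trans (ModP²-*Zʳ {1ℚ + P * (- S)} (Z-1PS { - S} (Z-neg {S} zS)) ex)
    (mkModP² (- (A * S * S)) (Z-neg {A * S * S} (Z-* {A * S} {S} (Z-* {A} {S} zA zS) zS))
      (solve 3 (λ A P S → A :* (con 1ℚ :+ P :* S) :* (con 1ℚ :+ P :* (:- S)) := A :+ P :* P :* (:- (A :* S :* S))) refl A P S)))

  Ex-scale : ∀ {X A S c} → Z c → Ex X A S → Ex (c * X) (c * A) S
  Ex-scale {X} {A} {S} {c} zc ex = ModP²-trans (ModP²-*Z {c} zc ex) (ModP²-≡ (sym (ℚP.*-assoc c A (1ℚ + P * S))))

  Un-Π : ∀ k (u : ℕ → ℚ) → (∀ j → j < k → Un (u j)) → Un (Π0 k u)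
  Un-Π zero u h = Un-1
  Un-Π (suc k) u h = Un-* {Π0 k u} {u k} (Un-Π k u (λ j j<k → h j (NP.m<n⇒m<1+n j<k))) (h k (NP.n<1+n k))

  Z-Π : ∀ k (u : ℕ → ℚ) → (∀ j → j < k → Z (u j)) → Z (Π0 k u)
  Z-Π zero u h = Z-1
  Z-Π (suc k) u h = Z-* {Π0 k u} {u k} (Z-Π k u (λ j j<k → h j (NP.m<n⇒m<1+n j<k))) (h k (NP.n<1+n k))

  Z-Σ : ∀ k (u : ℕ → ℚ) → (∀ j → j < k → Z (u j)) → Z (Σ0 k u)
  Z-Σ zero u h = Z-0
  Z-Σ (suc k) u h = Z-+ {Σ0 k u} {u k} (Z-Σ k u (λ j j<k → h j (NP.m<n⇒m<1+n j<k))) (h k (NP.n<1+n k))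

  ModP-Σ : ∀ k f g → (∀ j → j < k → ModP (f j) (g j)) → ModP (Σ0 k f) (Σ0 k g)
  ModP-Σ zero f g h = ModP-refl
  ModP-Σ (suc k) f g h = ModP-+ (ModP-Σ k f g (λ j j<k → h j (NP.m<n⇒m<1+n j<k))) (h k (NP.n<1+n k))

  ModP²-Σ : ∀ k f g → (∀ j → j < k → ModP² (f j) (g j)) → ModP² (Σ0 k f) (Σ0 k g)
  ModP²-Σ zero f g h = ModP²-refl
  ModP²-Σ (suc k) f g h = ModP²-+ (ModP²-Σ k f g (λ j j<k → h j (NP.m<n⇒m<1+n j<k))) (h k (NP.n<1+n k))

  Ex-Π : ∀ k (u e : ℕ → ℚ) → (∀ j → j < k → Un (u j)) → (∀ j → j < k → Z (e j)) →
         Ex (Π0 k (λ j → u j + P * e j)) (Π0 k u) (Σ0 k (λ j → e j * inv (u j)))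
  Ex-Π zero u e hu he = Ex-refl {1ℚ}
  Ex-Π (suc k) u e hu he =
    Ex-mul {Π0 k (λ j → u j + P * e j)} {u k + P * e k} {Π0 k u} {u k} {Σ0 k (λ j → e j * inv (u j))} {e k * inv (u k)}
      (Un⇒Z {Π0 k u} (Un-Π k u hu'))
      (Un⇒Z {u k} (hu k (NP.n<1+n k)))
      (Z-Σ k (λ j → e j * inv (u j)) (λ j j<k → Z-* {e j} {inv (u j)} (he' j j<k) (Z-inv {u j} (hu' j j<k))))
      (Z-* {e k} {inv (u k)} (he k (NP.n<1+n k)) (Z-inv {u k} (hu k (NP.n<1+n k))))
      (Ex-Π k u e hu' he')
      (Ex-lin {u k} {e k} (hu k (NP.n<1+n k)) (he k (NP.n<1+n k)))
    where
    hu' : ∀ j → j < k → Un (u j)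
    hu' = λ j j<k → hu j (NP.m<n⇒m<1+n j<k)
    he' : ∀ j → j < k → Z (e j)
    he' = λ j j<k → he j (NP.m<n⇒m<1+n j<k)

  Z-sq : ∀ {x} → Z x → Z (sq x)
  Z-sq {x} z = Z-* {x} {x} z z

  Ex-sq : ∀ {X A S} → Z A → Z S → Ex X A S → Ex (sq X) (sq A) (S + S)
  Ex-sq {X} {A} {S} zA zS e = Ex-mul {X} {X} {A} {A} {S} {S} zA zA zS zS e e

  Ex-trans : ∀ {X A B S T} → Z B → Z S → Z T → Ex X A S → Ex A B T → Ex X B (T + S)
  Ex-trans {X} {A} {B} {S} {T} zB zS zT e1 e2 = ModP²-trans e1 (ModP²-trans (ModP²-*Zʳ {1ℚ + P * S} (Z-1PS {S} zS) e2)
    (mkModP² (B * T * S) (Z-* {B * T} {S} (Z-* {B} {T} zB zT) zS)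
      (solve 4 (λ B T S P → B :* (con 1ℚ :+ P :* T) :* (con 1ℚ :+ P :* S) := B :* (con 1ℚ :+ P :* (T :+ S)) :+ P :* P :* (B :* T :* S)) refl B T S P)))

  ModP²-Π : ∀ k (f g : ℕ → ℚ) → (∀ j → j < k → ModP² (f j) (g j)) → (∀ j → j < k → Z (f j)) → (∀ j → j < k → Z (g j)) → ModP² (Π0 k f) (Π0 k g)
  ModP²-Π zero f g h zf zg = ModP²-refl
  ModP²-Π (suc k) f g h zf zg = ModP²-mul {Π0 k f} {Π0 k g} {f k} {g k} (Z-Π k f (λ j j<k → zf j (NP.m<n⇒m<1+n j<k))) (zg k (NP.n<1+n k))
    (ModP²-Π k f g (λ j j<k → h j (NP.m<n⇒m<1+n j<k)) (λ j j<k → zf j (NP.m<n⇒m<1+n j<k)) (λ j j<k → zg j (NP.m<n⇒m<1+n j<k)))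
    (h k (NP.n<1+n k))


module CentralBinomial where
  open import Data.Nat using (_!)
  import Data.Nat.Properties as NP
  open import Data.Nat.Combinatorics using (nCk≡n!/k![n-k]!; k![n∸k]!∣n!)
  open import Data.Nat.DivMod using (m*[n/m]≡n)
  import Data.Rational.Properties as ℚP
  open import Relation.Binary.PropositionalEquality
  open import Data.Rational.Solver using (module +-*-Solver)
  open +-*-Solver
  open ≡-Reasoning
  open RationalField
  open IteratedOps

  fact-Π : ∀ m → ι (m !) ≡ Π0 m (λ j → ι (suc j))
  fact-Π zero = refl
  fact-Π (suc m) = begin
    ι (suc m ℕ.* m !) ≡⟨ ι-* (suc m) (m !) ⟩
    ι (suc m) * ι (m !) ≡⟨ cong (ι (suc m) *_) (fact-Π m) ⟩
    ι (suc m) * Π0 m (λ j → ι (suc j)) ≡⟨ ℚP.*-comm (ι (suc m)) (Π0 m (λ j → ι (suc j))) ⟩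
    Π0 m (λ j → ι (suc j)) * ι (suc m) ∎

  Πodd : ℕ → ℚ
  Πodd k = Π0 k (λ j → ι (suc (j ℕ.+ j)))

  Πev : ℕ → ℚ
  Πev k = Π0 k (λ j → ι (suc (suc (j ℕ.+ j))))

  split2 : ∀ k → Π0 (k ℕ.+ k) (λ i → ι (suc i)) ≡ Πodd k * Πev k
  split2 zero = refl
  split2 (suc k) = begin
    Π0 (k ℕ.+ suc k) f * f (k ℕ.+ suc k) ≡⟨ cong (λ v → Π0 v f * f v) (NP.+-suc k k) ⟩
    Π0 (k ℕ.+ k) f * f (k ℕ.+ k) * f (suc (k ℕ.+ k)) ≡⟨ cong (λ v → v * f (k ℕ.+ k) * f (suc (k ℕ.+ k))) (split2 k) ⟩
    Πodd k * Πev k * f (k ℕ.+ k) * f (suc (k ℕ.+ k)) ≡⟨ solve 4 (λ a b c d → a :* b :* c :* d := a :* c :* (b :* d)) refl (Πodd k) (Πev k) (f (k ℕ.+ k)) (f (suc (k ℕ.+ k))) ⟩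
    Πodd k * f (k ℕ.+ k) * (Πev k * f (suc (k ℕ.+ k))) ∎
    where
    f : ℕ → ℚ
    f i = ι (suc i)

  Πev-eq : ∀ k → Πev k ≡ ι (2 ℕ.^ k) * ι (k !)
  Πev-eq zero = refl
  Πev-eq (suc k) = begin
    Πev k * ι (suc (suc (k ℕ.+ k))) ≡⟨ cong₂ _*_ (Πev-eq k) (trans (cong ι (lem k)) (ι-* 2 (suc k))) ⟩
    ι (2 ℕ.^ k) * ι (k !) * (ι 2 * ι (suc k)) ≡⟨ solve 4 (λ a b c d → a :* b :* (c :* d) := c :* a :* (d :* b)) refl (ι (2 ℕ.^ k)) (ι (k !)) (ι 2) (ι (suc k)) ⟩
    ι 2 * ι (2 ℕ.^ k) * (ι (suc k) * ι (k !)) ≡⟨ sym (cong₂ _*_ (ι-* 2 (2 ℕ.^ k)) (ι-* (suc k) (k !))) ⟩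
    ι (2 ℕ.^ suc k) * ι (suc k !) ∎
    where
    lem : ∀ k → suc (suc (k ℕ.+ k)) ≡ 2 ℕ.* suc k
    lem k = cong suc (trans (cong suc (cong (k ℕ.+_) (sym (NP.+-identityʳ k)))) (sym (NP.+-suc k (k ℕ.+ 0))))

  C-fact-ℕ : ∀ {n k} → k ≤ n → (n C k) ℕ.* (k ! ℕ.* (n ∸ k) !) ≡ n !
  C-fact-ℕ {n} {k} k≤n = trans (cong (ℕ._* (k ! ℕ.* (n ∸ k) !)) (nCk≡n!/k![n-k]! k≤n))
    (trans (NP.*-comm _ (k ! ℕ.* (n ∸ k) !)) (m*[n/m]≡n {{NP._!*_!≢0 k (n ∸ k)}} (k![n∸k]!∣n! k≤n)))

  C-fact : ∀ {n k} → k ≤ n → ι (n C k) * (ι (k !) * ι ((n ∸ k) !)) ≡ ι (n !)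
  C-fact {n} {k} k≤n = trans (cong (ι (n C k) *_) (sym (ι-* (k !) ((n ∸ k) !)))) (trans (sym (ι-* (n C k) _)) (cong ι (C-fact-ℕ k≤n)))

  16^k : ∀ k → 16 ℕ.^ k ≡ (2 ℕ.^ k ℕ.* 2 ℕ.^ k) ℕ.* (2 ℕ.^ k ℕ.* 2 ℕ.^ k)
  16^k zero = refl
  16^k (suc k) = trans (cong (16 ℕ.*_) (16^k k)) (NS.solve 1 (λ t → NS.con 16 NS.:* ((t NS.:* t) NS.:* (t NS.:* t)) NS.:= (NS.con 2 NS.:* t NS.:* (NS.con 2 NS.:* t)) NS.:* (NS.con 2 NS.:* t NS.:* (NS.con 2 NS.:* t))) refl (2 ℕ.^ k))
    where
    import Data.Nat.Solver as ℕSolver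
    module NS = ℕSolver.+-*-Solver

  ι-sq : ∀ m → ι (m ℕ.^ 2) ≡ sq (ι m)
  ι-sq m = trans (cong ι (cong (m ℕ.*_) (NP.*-identityʳ m))) (ι-* m m)

  pow2-nz : ∀ k → ι (2 ℕ.^ k) ≢ 0ℚ
  pow2-nz k = ιpos-nz (2 ℕ.^ k) (NP.m^n>0 2 k)

  fact-nz : ∀ m → ι (m !) ≢ 0ℚ
  fact-nz m = ιpos-nz (m !) (NP.1≤n! m)

  -- C(2k,k)·k! = 2^k·(1·3⋯(2k-1)), since C(2k,k)·k!·k! = (2k)! = Πodd k·2^k·k!.
  central-binomial-product : ∀ k → ι ((2 ℕ.* k) C k) * ι (k !) ≡ Πodd k * ι (2 ℕ.^ k)
  central-binomial-product k = cancelR _ _ (ι (k !)) (fact-nz k) (begin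
    ι B * ι (k !) * ι (k !)              ≡⟨ ℚP.*-assoc (ι B) (ι (k !)) (ι (k !)) ⟩
    ι B * (ι (k !) * ι (k !))            ≡⟨ cong (λ v → ι B * (ι (k !) * ι (v !))) (sym 2k∸k≡k) ⟩
    ι B * (ι (k !) * ι ((2 ℕ.* k ∸ k) !)) ≡⟨ C-fact k≤2k ⟩
    ι ((2 ℕ.* k) !)                      ≡⟨ cong (λ v → ι (v !)) (cong (k ℕ.+_) (NP.+-identityʳ k)) ⟩
    ι ((k ℕ.+ k) !)                      ≡⟨ fact-Π (k ℕ.+ k) ⟩
    Π0 (k ℕ.+ k) (λ i → ι (suc i))       ≡⟨ split2 k ⟩
    Πodd k * Πev k                       ≡⟨ cong (Πodd k *_) (Πev-eq k) ⟩
    Πodd k * (ι (2 ℕ.^ k) * ι (k !))     ≡⟨ sym (ℚP.*-assoc (Πodd k) (ι (2 ℕ.^ k)) (ι (k !))) ⟩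
    Πodd k * ι (2 ℕ.^ k) * ι (k !)       ∎)
    where
    B : ℕ
    B = (2 ℕ.* k) C k
    k≤2k : k ≤ 2 ℕ.* k
    k≤2k = NP.m≤m+n k (k ℕ.+ 0)
    2k∸k≡k : 2 ℕ.* k ∸ k ≡ k
    2k∸k≡k = trans (cong (_∸ k) (cong (k ℕ.+_) (NP.+-identityʳ k))) (NP.m+n∸m≡n k k)

  c-formula : ∀ k → c k ≡ sq (Πodd k * inv (Πev k))
  c-formula k = begin
    ι (B ℕ.^ 2) * inv (ι (16 ℕ.^ k))         ≡⟨ cong₂ (λ u v → u * inv v) (ι-sq B) ι-16^k ⟩
    sq X * inv (sq T * sq T)                  ≡⟨ cong (sq X *_) (trans (inv-* (sq T) (sq T) T²≢0 T²≢0) (cong₂ _*_ (inv-* T T T≢0 T≢0) (inv-* T T T≢0 T≢0))) ⟩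
    sq X * (iT * iT * (iT * iT))              ≡⟨ cong (λ v → sq v * (iT * iT * (iT * iT))) X≡ ⟩
    sq (Od * T * iF) * (iT * iT * (iT * iT))  ≡⟨ solve 4 (λ o t f i → (o :* t :* f) :* (o :* t :* f) :* (i :* i :* (i :* i)) := (o :* (i :* f)) :* (o :* (i :* f)) :* ((t :* i) :* (t :* i))) refl Od T iF iT ⟩
    sq (Od * (iT * iF)) * sq (T * iT)         ≡⟨ cong (λ v → sq (Od * (iT * iF)) * sq v) (inv-r T T≢0) ⟩
    sq (Od * (iT * iF)) * 1ℚ                  ≡⟨ ℚP.*-identityʳ _ ⟩
    sq (Od * (iT * iF))                       ≡⟨ cong (λ v → sq (Od * v)) (sym (trans (cong inv (Πev-eq k)) (inv-* T F T≢0 (fact-nz k)))) ⟩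
    sq (Πodd k * inv (Πev k))                 ∎
    where
    B : ℕ
    B = (2 ℕ.* k) C k
    X T F Od iT iF : ℚ
    X = ι B
    T = ι (2 ℕ.^ k)
    F = ι (k !)
    Od = Πodd k
    iT = inv T
    iF = inv F
    T≢0 : T ≢ 0ℚ
    T≢0 = pow2-nz k
    T²≢0 : sq T ≢ 0ℚ
    T²≢0 = mul-nz T T T≢0 T≢0
    ι-16^k : ι (16 ℕ.^ k) ≡ sq T * sq T
    ι-16^k = trans (cong ι (16^k k)) (trans (ι-* (2 ℕ.^ k ℕ.* 2 ℕ.^ k) (2 ℕ.^ k ℕ.* 2 ℕ.^ k)) (cong₂ _*_ (ι-* (2 ℕ.^ k) (2 ℕ.^ k)) (ι-* (2 ℕ.^ k) (2 ℕ.^ k))))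
    X≡ : X ≡ Od * T * iF
    X≡ = sym (div-eq (Od * T) X F (fact-nz k) (sym (central-binomial-product k)))

  γ : ℕ → ℕ → ℚ
  γ n k = Π0 k (λ j → ι (suc (n ℕ.+ n)) - ι (suc (j ℕ.+ j)))

  Πdesc : ℕ → ℕ → ℚ
  Πdesc n k = Π0 k (λ j → ι (n ∸ j))

  Πdesc-fact : ∀ n k → k ≤ n → Πdesc n k * ι ((n ∸ k) !) ≡ ι (n !)
  Πdesc-fact n zero _ = ℚP.*-identityˡ (ι (n !))
  Πdesc-fact n (suc k) k<n = begin
    Πdesc n k * ι (n ∸ k) * ι ((n ∸ suc k) !) ≡⟨ ℚP.*-assoc (Πdesc n k) (ι (n ∸ k)) (ι ((n ∸ suc k) !)) ⟩
    Πdesc n k * (ι (n ∸ k) * ι ((n ∸ suc k) !)) ≡⟨ cong (Πdesc n k *_) (sym (ι-* (n ∸ k) ((n ∸ suc k) !))) ⟩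
    Πdesc n k * ι ((n ∸ k) ℕ.* (n ∸ suc k) !) ≡⟨ cong (λ v → Πdesc n k * ι v) lem ⟩
    Πdesc n k * ι ((n ∸ k) !) ≡⟨ Πdesc-fact n k (NP.<⇒≤ k<n) ⟩
    ι (n !) ∎
    where
    lem : (n ∸ k) ℕ.* (n ∸ suc k) ! ≡ (n ∸ k) !
    lem = trans (cong (λ v → v ℕ.* (n ∸ suc k) !) (NP.+-∸-assoc 1 k<n)) (cong _! (sym (NP.+-∸-assoc 1 k<n)))

  γ-eq : ∀ n k → k ≤ n → γ n k ≡ ι (2 ℕ.^ k) * Πdesc n k
  γ-eq n zero _ = refl
  γ-eq n (suc k) k<n = begin
    γ n k * (ι (suc (n ℕ.+ n)) - ι (suc (k ℕ.+ k))) ≡⟨ cong₂ _*_ (γ-eq n k (NP.<⇒≤ k<n)) fac ⟩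
    ι (2 ℕ.^ k) * Πdesc n k * (ι 2 * ι (n ∸ k)) ≡⟨ solve 4 (λ a b c d → a :* b :* (c :* d) := c :* a :* (b :* d)) refl (ι (2 ℕ.^ k)) (Πdesc n k) (ι 2) (ι (n ∸ k)) ⟩
    ι 2 * ι (2 ℕ.^ k) * (Πdesc n k * ι (n ∸ k)) ≡⟨ cong (_* (Πdesc n k * ι (n ∸ k))) (sym (ι-* 2 (2 ℕ.^ k))) ⟩
    ι (2 ℕ.^ suc k) * Πdesc n (suc k) ∎
    where
    fac : ι (suc (n ℕ.+ n)) - ι (suc (k ℕ.+ k)) ≡ ι 2 * ι (n ∸ k)
    fac = begin
      ι (suc (n ℕ.+ n)) - ι (suc (k ℕ.+ k)) ≡⟨ cong₂ _-_ (ι-odd n) (ι-odd k) ⟩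
      (1ℚ + ι n + ι n) - (1ℚ + ι k + ι k) ≡⟨ solve 2 (λ x y → (con 1ℚ :+ x :+ x) :- (con 1ℚ :+ y :+ y) := (con 1ℚ :+ con 1ℚ) :* (x :- y)) refl (ι n) (ι k) ⟩
      (1ℚ + 1ℚ) * (ι n - ι k) ≡⟨ cong₂ _*_ (sym ι2) (sym (ι-minus (NP.<⇒≤ k<n))) ⟩
      ι 2 * ι (n ∸ k) ∎


  binom-γ : ∀ n k → k ≤ n → ι (n C k) * Πev k ≡ γ n k
  binom-γ n k k≤n = begin
    ι (n C k) * Πev k ≡⟨ cong (ι (n C k) *_) (Πev-eq k) ⟩
    ι (n C k) * (ι (2 ℕ.^ k) * ι (k !)) ≡⟨ solve 3 (λ a b c → a :* (b :* c) := b :* (a :* c)) refl (ι (n C k)) (ι (2 ℕ.^ k)) (ι (k !)) ⟩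
    ι (2 ℕ.^ k) * (ι (n C k) * ι (k !)) ≡⟨ cong (ι (2 ℕ.^ k) *_) core ⟩
    ι (2 ℕ.^ k) * Πdesc n k ≡⟨ sym (γ-eq n k k≤n) ⟩
    γ n k ∎
    where
    core : ι (n C k) * ι (k !) ≡ Πdesc n k
    core = cancelR _ _ (ι ((n ∸ k) !)) (fact-nz (n ∸ k))
      (trans (ℚP.*-assoc (ι (n C k)) (ι (k !)) (ι ((n ∸ k) !))) (trans (C-fact k≤n) (sym (Πdesc-fact n k k≤n))))


-- With
--   Q N k = Π_{j<k} ((2j+1)² - (2N+1)²)/(2j+2)²
-- we have, for x avoiding 0, -1, …, -N,
--   Σ_{k≤N} Q N k/(x+k) = Π_{j<N} (j+1-x) / Π_{j≤N} (x+j).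
-- It is proved by induction on N, splitting each term Q (N+1) k/(x+k) by the
-- recurrence Qrec; the coefficient of the new pole -(N+1) is computed from Q-product.
module PartialFractions where
  import Data.Nat.Properties as NP
  import Data.Rational.Properties as ℚP
  open import Relation.Binary.PropositionalEquality
  open import Data.Rational.Solver using (module +-*-Solver)
  open +-*-Solver
  open ≡-Reasoning
  open RationalField
  open IteratedOps
  open CentralBinomial

  Ev : ℕ → ℚ
  Ev j = 1ℚ + 1ℚ + ι j + ι j

  fN : ℕ → ℕ → ℚ
  fN N j = (sq (1ℚ + ι j + ι j) - sq (1ℚ + ι N + ι N)) * inv (sq (Ev j))

  Q : ℕ → ℕ → ℚ
  Q N k = Π0 k (fN N)

  Ev-nz : ∀ j → Ev j ≢ 0ℚ
  Ev-nz j e = ι-nz (suc (j ℕ.+ j)) (trans (ι-ev j) e)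

  sqnz : ∀ x → x ≢ 0ℚ → sq x ≢ 0ℚ
  sqnz x xn = mul-nz x x xn xn

  f-form : ∀ N k → fN N k ≡ (ι k - ι N) * (ι k + ι N + 1ℚ) * inv (sq (ι (suc k)))
  f-form N k = sym (div-eq _ _ (sq (ι (suc k))) (sqnz _ (ι-nz k)) (begin
    (x - y) * (x + y + 1ℚ) ≡⟨ sym (ℚP.*-identityʳ _) ⟩
    (x - y) * (x + y + 1ℚ) * 1ℚ ≡⟨ cong ((x - y) * (x + y + 1ℚ) *_) (sym (inv-r (sq (Ev k)) (sqnz _ (Ev-nz k)))) ⟩
    (x - y) * (x + y + 1ℚ) * (sq (Ev k) * iE) ≡⟨ solve 3 (λ x y iE → (x :- y) :* (x :+ y :+ con 1ℚ) :* ((con 1ℚ :+ con 1ℚ :+ x :+ x) :* (con 1ℚ :+ con 1ℚ :+ x :+ x) :* iE) := ((con 1ℚ :+ x :+ x) :* (con 1ℚ :+ x :+ x) :- (con 1ℚ :+ y :+ y) :* (con 1ℚ :+ y :+ y)) :* iE :* ((con 1ℚ :+ x) :* (con 1ℚ :+ x))) refl x y iE ⟩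
    fN N k * sq (1ℚ + x) ≡⟨ cong (λ v → fN N k * sq v) (sym (ι-suc k)) ⟩
    fN N k * sq (ι (suc k)) ∎))
    where
    x : ℚ
    x = ι k
    y : ℚ
    y = ι N
    iE : ℚ
    iE = inv (sq (Ev k))

  Qrec : ∀ N k → k ≤ N → Q (suc N) k * (ι (suc N) - ι k) ≡ Q N k * (ι (suc N) + ι k)
  Qrec N zero _ = solve 1 (λ m → con 1ℚ :* (m :- con 0ℚ) := con 1ℚ :* (m :+ con 0ℚ)) refl (ι (suc N))
  Qrec N (suc k) k<N = cancelR _ _ (M - x) (ι-sub-nz (s≤s (NP.<⇒≤ k<N))) (begin
    A * f1 * (M - ι (suc k)) * (M - x) ≡⟨ solve 5 (λ A f1 M s x → A :* f1 :* (M :- s) :* (M :- x) := (A :* (M :- x)) :* f1 :* (M :- s)) refl A f1 M (ι (suc k)) x ⟩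
    (A * (M - x)) * f1 * (M - ι (suc k)) ≡⟨ cong (λ v → v * f1 * (M - ι (suc k))) (Qrec N k (NP.<⇒≤ k<N)) ⟩
    (B * (M + x)) * f1 * (M - ι (suc k)) ≡⟨ cong (λ v → (B * (M + x)) * v * (M - ι (suc k))) (f-form (suc N) k) ⟩
    (B * (M + x)) * ((x - M) * (x + M + 1ℚ) * iS) * (M - ι (suc k)) ≡⟨ cong₂ (λ m s → (B * (m + x)) * ((x - m) * (x + m + 1ℚ) * iS) * (m - s)) eM es ⟩
    (B * ((1ℚ + y) + x)) * ((x - (1ℚ + y)) * (x + (1ℚ + y) + 1ℚ) * iS) * ((1ℚ + y) - (1ℚ + x)) ≡⟨ solve 4 (λ B x y iS → (B :* ((con 1ℚ :+ y) :+ x)) :* ((x :- (con 1ℚ :+ y)) :* (x :+ (con 1ℚ :+ y) :+ con 1ℚ) :* iS) :* ((con 1ℚ :+ y) :- (con 1ℚ :+ x)) := B :* ((x :- y) :* (x :+ y :+ con 1ℚ) :* iS) :* ((con 1ℚ :+ y) :+ (con 1ℚ :+ x)) :* ((con 1ℚ :+ y) :- x)) refl B x y iS ⟩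
    B * ((x - y) * (x + y + 1ℚ) * iS) * ((1ℚ + y) + (1ℚ + x)) * ((1ℚ + y) - x) ≡⟨ sym (cong₂ (λ m s → B * ((x - y) * (x + y + 1ℚ) * iS) * (m + s) * (m - x)) eM es) ⟩
    B * ((x - y) * (x + y + 1ℚ) * iS) * (M + ι (suc k)) * (M - x) ≡⟨ cong (λ v → B * v * (M + ι (suc k)) * (M - x)) (sym (f-form N k)) ⟩
    B * f0 * (M + ι (suc k)) * (M - x) ∎)
    where
    A : ℚ
    A = Q (suc N) k
    B : ℚ
    B = Q N k
    M : ℚ
    M = ι (suc N)
    x : ℚ
    x = ι k
    y : ℚ
    y = ι N
    f1 : ℚ
    f1 = fN (suc N) k
    f0 : ℚ
    f0 = fN N k
    iS : ℚ
    iS = inv (sq (ι (suc k)))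
    eM : M ≡ 1ℚ + y
    eM = ι-suc N
    es : ι (suc k) ≡ 1ℚ + x
    es = ι-suc k

  Πneg : ℕ → ℚ
  Πneg k = Π0 k (λ m → - ι (suc m))

  Πf : ℕ → ℚ
  Πf l = Π0 l (λ i → ι (suc i))

  Πsh : ℕ → ℕ → ℚ
  Πsh n k = Π0 n (λ j → ι (suc (j ℕ.+ k)))

  Πsh-step : ∀ n k → Πsh n k * ι (suc (n ℕ.+ k)) ≡ ι (suc k) * Πsh n (suc k)
  Πsh-step n k = trans (Π0-first n (λ j → ι (suc (j ℕ.+ k))))
    (cong (ι (suc k) *_) (Π0-cong n (λ j _ → cong (λ v → ι (suc v)) (sym (NP.+-suc j k)))))

  f-neg : ∀ N k → fN N k * (- ι (suc k)) * ι (suc k) ≡ (ι N - ι k) * (ι k + ι N + 1ℚ)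
  f-neg N k = begin
    fN N k * (- s) * s ≡⟨ cong (λ v → v * (- s) * s) (f-form N k) ⟩
    (x - y) * (x + y + 1ℚ) * iS * (- s) * s ≡⟨ solve 4 (λ x y iS s → (x :- y) :* (x :+ y :+ con 1ℚ) :* iS :* (:- s) :* s := (y :- x) :* (x :+ y :+ con 1ℚ) :* (s :* s :* iS)) refl x y iS s ⟩
    (y - x) * (x + y + 1ℚ) * (sq s * iS) ≡⟨ cong ((y - x) * (x + y + 1ℚ) *_) (inv-r (sq s) (sqnz s (ι-nz k))) ⟩
    (y - x) * (x + y + 1ℚ) * 1ℚ ≡⟨ ℚP.*-identityʳ _ ⟩
    (y - x) * (x + y + 1ℚ) ∎
    where
    x : ℚ
    x = ι k
    y : ℚ
    y = ι N
    s : ℚ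
    s = ι (suc k)
    iS : ℚ
    iS = inv (sq s)

  Q-product : ∀ n k l → k ℕ.+ l ≡ n → Q n k * Πneg k * Πf l ≡ Πsh n k
  Q-product n zero l refl = trans (ℚP.*-identityˡ (Πf l)) (Π0-cong l (λ j _ → cong (λ v → ι (suc v)) (sym (NP.+-identityʳ j))))
  Q-product n (suc k) l eq = cancelR _ _ s (ι-nz k) (begin
    Q n k * fN n k * (Πneg k * (- s)) * Πf l * s ≡⟨ solve 6 (λ q f a m b s → q :* f :* (a :* m) :* b :* s := (q :* a :* b) :* (f :* m :* s)) refl (Q n k) (fN n k) (Πneg k) (- s) (Πf l) s ⟩
    (Q n k * Πneg k * Πf l) * (fN n k * (- s) * s) ≡⟨ cong ((Q n k * Πneg k * Πf l) *_) (f-neg n k) ⟩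
    (Q n k * Πneg k * Πf l) * ((ι n - ι k) * (ι k + ι n + 1ℚ)) ≡⟨ cong₂ (λ a b → (Q n k * Πneg k * Πf l) * (a * b)) e1 e2 ⟩
    (Q n k * Πneg k * Πf l) * (ι (suc l) * ι (suc (n ℕ.+ k))) ≡⟨ sym (ℚP.*-assoc (Q n k * Πneg k * Πf l) (ι (suc l)) (ι (suc (n ℕ.+ k)))) ⟩
    (Q n k * Πneg k * Πf l) * ι (suc l) * ι (suc (n ℕ.+ k)) ≡⟨ cong (_* ι (suc (n ℕ.+ k))) (trans (ℚP.*-assoc (Q n k * Πneg k) (Πf l) (ι (suc l))) (Q-product n k (suc l) eq')) ⟩
    Πsh n k * ι (suc (n ℕ.+ k)) ≡⟨ Πsh-step n k ⟩
    s * Πsh n (suc k) ≡⟨ ℚP.*-comm s (Πsh n (suc k)) ⟩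
    Πsh n (suc k) * s ∎)
    where
    s : ℚ
    s = ι (suc k)
    eq' : k ℕ.+ suc l ≡ n
    eq' = trans (NP.+-suc k l) eq
    e1 : ι n - ι k ≡ ι (suc l)
    e1 = trans (sym (ι-minus (subst (k ℕ.≤_) eq' (NP.m≤m+n k (suc l))))) (cong ι (trans (cong (_∸ k) (sym eq')) (NP.m+n∸m≡n k (suc l))))
    e2 : ι k + ι n + 1ℚ ≡ ι (suc (n ℕ.+ k))
    e2 = trans (solve 2 (λ a b → a :+ b :+ con 1ℚ := con 1ℚ :+ (b :+ a)) refl (ι k) (ι n)) (trans (cong (1ℚ +_) (sym (ι-+ n k))) (sym (ι-suc (n ℕ.+ k))))

  S : ℕ → ℚ → ℚ
  S N x = Σ0 (suc N) (λ k → Q N k * inv (x + ι k))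

  Num : ℕ → ℚ → ℚ
  Num N x = Π0 N (λ j → ι (suc j) - x)

  Den : ℕ → ℚ → ℚ
  Den N x = Π0 (suc N) (λ j → x + ι j)

  split-term : ∀ A B M x k → A * (M - k) ≡ B * (M + k) →
         x + k ≢ 0ℚ → M - k ≢ 0ℚ → x + M ≢ 0ℚ →
         A * inv (x + k) ≡ ((M - x) * inv (x + M)) * (B * inv (x + k)) + ((M + M) * inv (x + M)) * (B * inv (M - k))
  split-term A B M x k h n1 n2 n3 = cancelR _ _ (d1 * d2 * d3) (mul-nz _ _ (mul-nz _ _ n1 n2) n3) (begin
    A * i1 * (d1 * d2 * d3) ≡⟨ solve 5 (λ A i1 d1 d2 d3 → A :* i1 :* (d1 :* d2 :* d3) := (A :* d2) :* d3 :* (i1 :* d1)) refl A i1 d1 d2 d3 ⟩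
    (A * d2) * d3 * (i1 * d1) ≡⟨ cong₂ (λ a b → a * d3 * b) h (inv-l d1 n1) ⟩
    B * (M + k) * d3 * 1ℚ ≡⟨ solve 5 (λ B M k x d3 → B :* (M :+ k) :* (x :+ M) :* con 1ℚ := (M :- x) :* B :* (M :- k) :* con 1ℚ :* con 1ℚ :+ (M :+ M) :* B :* (x :+ k) :* con 1ℚ :* con 1ℚ) refl B M k x d3 ⟩
    (M - x) * B * d2 * 1ℚ * 1ℚ + (M + M) * B * d1 * 1ℚ * 1ℚ ≡⟨ cong₂ _+_ (cong₂ (λ a b → (M - x) * B * d2 * a * b) (sym (inv-l d1 n1)) (sym (inv-l d3 n3))) (cong₂ (λ a b → (M + M) * B * d1 * a * b) (sym (inv-l d2 n2)) (sym (inv-l d3 n3))) ⟩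
    (M - x) * B * d2 * (i1 * d1) * (i3 * d3) + (M + M) * B * d1 * (i2 * d2) * (i3 * d3) ≡⟨ solve 9 (λ Mx MM B d1 d2 d3 i1 i2 i3 → Mx :* B :* d2 :* (i1 :* d1) :* (i3 :* d3) :+ MM :* B :* d1 :* (i2 :* d2) :* (i3 :* d3) := (Mx :* i3 :* (B :* i1) :+ MM :* i3 :* (B :* i2)) :* (d1 :* d2 :* d3)) refl (M - x) (M + M) B d1 d2 d3 i1 i2 i3 ⟩
    (((M - x) * i3) * (B * i1) + ((M + M) * i3) * (B * i2)) * (d1 * d2 * d3) ∎)
    where
    d1 : ℚ
    d1 = x + k
    d2 : ℚ
    d2 = M - k
    d3 : ℚ
    d3 = x + M
    i1 : ℚ
    i1 = inv d1
    i2 : ℚ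
    i2 = inv d2
    i3 : ℚ
    i3 = inv d3

  Den-neg : ∀ N → Den N (- ι (suc N)) ≡ Πneg (suc N)
  Den-neg N = trans (sym (Π0-rev (suc N) g)) (Π0-cong (suc N) λ j j<sN → lem j (NP.≤-pred j<sN))
    where
    g : ℕ → ℚ
    g j = - ι (suc N) + ι j
    lem : ∀ j → j ≤ N → g (N ∸ j) ≡ - ι (suc j)
    lem j j≤N = begin
      - ι (suc N) + ι (N ∸ j) ≡⟨ cong (- ι (suc N) +_) (ι-minus j≤N) ⟩
      - ι (suc N) + (ι N - ι j) ≡⟨ cong (λ v → - v + (ι N - ι j)) (ι-suc N) ⟩
      - (1ℚ + ι N) + (ι N - ι j) ≡⟨ solve 2 (λ a b → :- (con 1ℚ :+ a) :+ (a :- b) := :- (con 1ℚ :+ b)) refl (ι N) (ι j) ⟩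
      - (1ℚ + ι j) ≡⟨ cong -_ (sym (ι-suc j)) ⟩
      - ι (suc j) ∎

  Num-neg : ∀ N → Num N (- ι (suc N)) ≡ Πsh N (suc N)
  Num-neg N = Π0-cong N λ j _ → trans (solve 2 (λ a b → a :- (:- b) := a :+ b) refl (ι (suc j)) (ι (suc N))) (sym (ι-+ (suc j) (suc N)))

  Qlast : ∀ N → Q (suc N) (suc N) * Den N (- ι (suc N)) ≡ (ι (suc N) + ι (suc N)) * Num N (- ι (suc N))
  Qlast N = begin
    Q (suc N) (suc N) * Den N (- M) ≡⟨ cong (Q (suc N) (suc N) *_) (Den-neg N) ⟩
    Q (suc N) (suc N) * Πneg (suc N) ≡⟨ sym (ℚP.*-identityʳ _) ⟩
    Q (suc N) (suc N) * Πneg (suc N) * Πf 0 ≡⟨ Q-product (suc N) (suc N) 0 (NP.+-identityʳ (suc N)) ⟩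
    Πsh (suc N) (suc N) ≡⟨ refl ⟩
    Πsh N (suc N) * ι (suc (N ℕ.+ suc N)) ≡⟨ cong₂ _*_ (sym (Num-neg N)) (ι-+ (suc N) (suc N)) ⟩
    Num N (- M) * (M + M) ≡⟨ ℚP.*-comm (Num N (- M)) (M + M) ⟩
    (M + M) * Num N (- M) ∎
    where M = ι (suc N)

  neg-pole-nz : ∀ N j → j ≤ N → - ι (suc N) + ι j ≢ 0ℚ
  neg-pole-nz N j j≤N e = ι-sub-nz (s≤s j≤N)
    (trans (solve 2 (λ a b → a :- b := :- (:- a :+ b)) refl (ι (suc N)) (ι j)) (cong -_ e))

  reflected-sum : ∀ N → Σ0 (suc N) (λ k → Q N k * inv (ι (suc N) - ι k)) ≡ - S N (- ι (suc N))
  reflected-sum N = begin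
    T                                                   ≡⟨ solve 1 (λ t → t := :- (con (- 1ℚ) :* t)) refl T ⟩
    - (- 1ℚ * T)                                        ≡⟨ cong -_ (sym (Σ0-scale (suc N) (- 1ℚ) _)) ⟩
    - Σ0 (suc N) (λ k → - 1ℚ * (Q N k * inv (M - ι k))) ≡⟨ cong -_ (Σ0-cong (suc N) (λ k _ → flip k)) ⟩
    - S N (- M)                                         ∎
    where
    M : ℚ
    M = ι (suc N)
    T : ℚ
    T = Σ0 (suc N) (λ k → Q N k * inv (M - ι k))
    flip : ∀ k → - 1ℚ * (Q N k * inv (M - ι k)) ≡ Q N k * inv (- M + ι k)
    flip k = begin
      - 1ℚ * (Q N k * inv (M - ι k)) ≡⟨ solve 2 (λ q i → con (- 1ℚ) :* (q :* i) := q :* (:- i)) refl (Q N k) (inv (M - ι k)) ⟩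
      Q N k * - inv (M - ι k)        ≡⟨ cong (Q N k *_) (sym (inv-neg (M - ι k))) ⟩
      Q N k * inv (- (M - ι k))      ≡⟨ cong (λ v → Q N k * inv v) (solve 2 (λ a b → :- (a :- b) := :- a :+ b) refl M (ι k)) ⟩
      Q N k * inv (- M + ι k)        ∎

  last-coefficient : ∀ N → Q (suc N) (suc N) ≡ (ι (suc N) + ι (suc N)) * (Num N (- ι (suc N)) * inv (Den N (- ι (suc N))))
  last-coefficient N = cancelR _ _ D D≢0 (begin
    Q (suc N) (suc N) * D                ≡⟨ Qlast N ⟩
    (M + M) * Num N (- M)                ≡⟨ cong ((M + M) *_) (sym (div-eq _ _ D D≢0 refl)) ⟩
    (M + M) * (Num N (- M) * D * inv D)  ≡⟨ solve 4 (λ m n d i → m :* (n :* d :* i) := m :* (n :* i) :* d) refl (M + M) (Num N (- M)) D (inv D) ⟩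
    (M + M) * (Num N (- M) * inv D) * D  ∎)
    where
    M : ℚ
    M = ι (suc N)
    D : ℚ
    D = Den N (- M)
    D≢0 : D ≢ 0ℚ
    D≢0 = Π-nz (suc N) (λ j → - M + ι j) (λ j j<sN → neg-pole-nz N j (NP.≤-pred j<sN))

  -- Induction step: split each term by `split-term` (with the recurrence Qrec), use the
  -- identity for N at x and at -(N+1), and collect the new pole -(N+1).
  partial-fractions-step : ∀ N →
    (∀ y → (∀ j → j ≤ N → y + ι j ≢ 0ℚ) → S N y ≡ Num N y * inv (Den N y)) →
    ∀ x → (∀ j → j ≤ suc N → x + ι j ≢ 0ℚ) → S (suc N) x ≡ Num (suc N) x * inv (Den (suc N) x)
  partial-fractions-step N IH x h = begin
    Σ0 (suc N) (λ k → Q (suc N) k * inv (x + ι k)) + Qs * inv (x + M)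
      ≡⟨ cong (_+ Qs * inv (x + M)) (Σ0-cong (suc N) split) ⟩
    Σ0 (suc N) (λ k → α * (Q N k * inv (x + ι k)) + β * (Q N k * inv (M - ι k))) + Qs * inv (x + M)
      ≡⟨ cong (_+ Qs * inv (x + M)) (trans (Σ0-add (suc N) _ _) (cong₂ _+_ (Σ0-scale (suc N) α _) (Σ0-scale (suc N) β _))) ⟩
    α * S N x + β * Σ0 (suc N) (λ k → Q N k * inv (M - ι k)) + Qs * inv (x + M)
      ≡⟨ cong₂ (λ u v → α * u + β * v + Qs * inv (x + M)) (IH x (λ j j≤N → h j (NP.m≤n⇒m≤1+n j≤N)))
               (trans (reflected-sum N) (cong -_ (IH (- M) (neg-pole-nz N)))) ⟩
    α * R0 + β * (- Rm) + Qs * inv (x + M)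
      ≡⟨ cong (λ v → α * R0 + β * (- Rm) + v * inv (x + M)) (last-coefficient N) ⟩
    α * R0 + β * (- Rm) + (M + M) * Rm * inv (x + M)
      ≡⟨ solve 5 (λ Mx MM iX R0 Rm → Mx :* iX :* R0 :+ MM :* iX :* (:- Rm) :+ MM :* Rm :* iX := R0 :* (Mx :* iX)) refl (M - x) (M + M) (inv (x + M)) R0 Rm ⟩
    R0 * α
      ≡⟨ solve 4 (λ a b c d → a :* b :* (c :* d) := a :* c :* (b :* d)) refl (Num N x) (inv (Den N x)) (M - x) (inv (x + M)) ⟩
    Num N x * (M - x) * (inv (Den N x) * inv (x + M))
      ≡⟨ cong (Num N x * (M - x) *_) (sym (inv-* (Den N x) (x + M) Den≢0 x+M≢0)) ⟩
    Num N x * (M - x) * inv (Den N x * (x + M)) ∎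
    where
    M : ℚ
    M = ι (suc N)
    Qs : ℚ
    Qs = Q (suc N) (suc N)
    α : ℚ
    α = (M - x) * inv (x + M)
    β : ℚ
    β = (M + M) * inv (x + M)
    R0 : ℚ
    R0 = Num N x * inv (Den N x)
    Rm : ℚ
    Rm = Num N (- M) * inv (Den N (- M))
    x+M≢0 : x + M ≢ 0ℚ
    x+M≢0 = h (suc N) NP.≤-refl
    Den≢0 : Den N x ≢ 0ℚ
    Den≢0 = Π-nz (suc N) (λ j → x + ι j) (λ j j<sN → h j (NP.<⇒≤ j<sN))
    split : ∀ k → k < suc N → Q (suc N) k * inv (x + ι k) ≡ α * (Q N k * inv (x + ι k)) + β * (Q N k * inv (M - ι k))
    split k k<sN = split-term (Q (suc N) k) (Q N k) M x (ι k) (Qrec N k (NP.≤-pred k<sN)) (h k (NP.<⇒≤ k<sN)) (ι-sub-nz k<sN) x+M≢0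

  partial-fractions : ∀ N x → (∀ j → j ≤ N → x + ι j ≢ 0ℚ) → S N x ≡ Num N x * inv (Den N x)
  partial-fractions zero x h = begin
    0ℚ + 1ℚ * inv (x + ι 0)    ≡⟨ solve 1 (λ a → con 0ℚ :+ con 1ℚ :* a := con 1ℚ :* a) refl (inv (x + ι 0)) ⟩
    1ℚ * inv (x + ι 0)         ≡⟨ cong (λ v → 1ℚ * inv v) (sym (ℚP.*-identityˡ (x + ι 0))) ⟩
    1ℚ * inv (1ℚ * (x + ι 0))  ∎
  partial-fractions (suc N) = partial-fractions-step N (partial-fractions N)


module OddPrime (p : ℕ) (pr : Prime p) (n : ℕ) (pn : p ≡ suc (n ℕ.+ n)) where
  import Data.Nat.Properties as NP
  open import Relation.Binary.PropositionalEquality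
  open import Data.Empty using (⊥-elim)
  open import Data.Rational.Solver using (module +-*-Solver)
  open +-*-Solver
  open RationalField
  open PIntegers p pr public
  open Congruences p pr public
  open Expansions p pr public

  Peq : P ≡ ι (suc (n ℕ.+ n))
  Peq = cong ι pn

  n≥1 : 1 ≤ n
  n≥1 = go n pn
    where
    go : ∀ m → p ≡ suc (m ℕ.+ m) → 1 ≤ m
    go zero e = ⊥-elim (NP.<-irrefl refl (subst (1 <_) e p>1))
    go (suc m) _ = s≤s z≤n

  lt-p : ∀ {m} → m ≤ n ℕ.+ n → m < p
  lt-p {m} h = subst (m <_) (sym pn) (s≤s h)

  Un-pos : ∀ m → 0 < m → m ≤ n ℕ.+ n → Un (ι m)
  Un-pos m 0<m h = Un-ι m 0<m (lt-p h)

  Un-suc : ∀ j → j < n ℕ.+ n → Un (ι (suc j))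
  Un-suc j h = Un-pos (suc j) (s≤s z≤n) h

  Un-2 : Un (ι 2)
  Un-2 = Un-pos 2 (s≤s z≤n) (NP.+-mono-≤ n≥1 n≥1)

  Un-odd : ∀ j → j < n → Un (ι (suc (j ℕ.+ j)))
  Un-odd j h = Un-pos (suc (j ℕ.+ j)) (s≤s z≤n) (NP.+-mono-≤ h (NP.<⇒≤ h))

  ev-eq : ∀ j → ι (suc (suc (j ℕ.+ j))) ≡ ι 2 * ι (suc j)
  ev-eq j = trans (ι-ev j) (trans (solve 1 (λ x → con 1ℚ :+ con 1ℚ :+ x :+ x := (con 1ℚ :+ con 1ℚ) :* (con 1ℚ :+ x)) refl (ι j)) (cong₂ _*_ (sym ι2) (sym (ι-suc j))))

  Un-ev : ∀ j → j < n ℕ.+ n → Un (ι (suc (suc (j ℕ.+ j))))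
  Un-ev j h = Un-≡ (sym (ev-eq j)) (Un-* {ι 2} {ι (suc j)} Un-2 (Un-suc j h))

  inv-compl : ∀ x y → Un x → Un y → x + y ≡ P → ModP (inv x) (- inv y)
  inv-compl x y ux uy e = ModP-trans {inv x} {inv (- y)} (ModP-inv {x} { - y} ux (Un-neg {y} uy) (mkModP 1ℚ Z-1 xe)) (ModP-≡ (inv-neg y))
    where
    xe : x ≡ - y + P * 1ℚ
    xe = trans (solve 2 (λ x y → x := :- y :+ (x :+ y) :* con 1ℚ) refl x y) (cong (λ v → - y + v * 1ℚ) e)

  half : ℚ
  half = inv (ι 2)

  two-half : ι 2 * half ≡ 1ℚ
  two-half = inv-r (ι 2) (Un-nz {ι 2} Un-2)

  Z-half : Z half
  Z-half = Z-inv {ι 2} Un-2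


module HarmonicFermat (p : ℕ) (pr : Prime p) (n : ℕ) (pn : p ≡ suc (n ℕ.+ n)) where
  import Data.Nat.Properties as NP
  import Data.Rational.Properties as ℚP
  open import Relation.Binary.PropositionalEquality
  open import Data.Rational.Solver using (module +-*-Solver)
  open +-*-Solver
  open ≡-Reasoning
  open RationalField
  open IteratedOps
  open CentralBinomial
  open OddPrime p pr n pn

  ∸-peel : ∀ m t → suc t ≤ m → m ∸ t ≡ suc (m ∸ suc t)
  ∸-peel (suc m) zero _ = refl
  ∸-peel (suc m) (suc t) (s≤s h) = ∸-peel m t h

  2n : ℕ
  2n = n ℕ.+ n

  -- H_{2n-t} ≡ H_{2n} + H_t (mod p), pairing 1/(2n+1-i) with -1/i.
  H-complement : ∀ t → t ≤ 2n → ModP (H (2n ∸ t)) (H 2n + H t)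
  H-complement zero _ = ModP-≡ (sym (ℚP.+-identityʳ (H 2n)))
  H-complement (suc t) h = ModP-trans {H m} {(H 2n + H t) - inv (ι (suc m))}
     (ModP-trans {H m} {H (suc m) - inv (ι (suc m))} (ModP-≡ hm) (ModP-+ {H (suc m)} {H 2n + H t} { - inv (ι (suc m))} (subst (λ v → ModP (H v) (H 2n + H t)) em (H-complement t (NP.<⇒≤ h))) ModP-refl))
     (ModP-trans {(H 2n + H t) - inv (ι (suc m))} {(H 2n + H t) - - inv (ι (suc t))}
       (ModP-+ {H 2n + H t} {H 2n + H t} { - inv (ι (suc m))} ModP-refl (ModP-neg (inv-compl (ι (suc m)) (ι (suc t)) (Un-suc m m<) (Un-suc t h) sumP)))
       (ModP-≡ (solve 3 (λ a b c → (a :+ b) :- (:- c) := a :+ (b :+ c)) refl (H 2n) (H t) (inv (ι (suc t))))))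
    where
    m : ℕ
    m = 2n ∸ suc t
    em : 2n ∸ t ≡ suc m
    em = ∸-peel 2n t h
    hm : H m ≡ H (suc m) - inv (ι (suc m))
    hm = solve 2 (λ a b → a := (a :+ b) :- b) refl (H m) (inv (ι (suc m)))
    m< : m < 2n
    m< = NP.<-≤-trans (NP.n<1+n m) (subst (_≤ 2n) em (NP.m∸n≤m 2n t))
    sumP : ι (suc m) + ι (suc t) ≡ P
    sumP = trans (sym (ι-+ (suc m) (suc t))) (trans (cong (λ v → ι (suc v)) (NP.m∸n+n≡m h)) (sym Peq))

  H2n≡0 : ModP (H 2n) 0ℚ
  H2n≡0 = ModP-trans {H 2n} {half * (H 2n + H 2n)} (ModP-≡ e0) (ModP-trans {half * (H 2n + H 2n)} {half * 0ℚ} (ModP-*Z {half} Z-half (ModP-sym k0)) (ModP-≡ (ℚP.*-zeroʳ half)))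
    where
    k0 : ModP 0ℚ (H 2n + H 2n)
    k0 = subst (λ v → ModP (H v) (H 2n + H 2n)) (NP.n∸n≡0 2n) (H-complement 2n NP.≤-refl)
    e0 : H 2n ≡ half * (H 2n + H 2n)
    e0 = begin
      H 2n ≡⟨ sym (ℚP.*-identityˡ (H 2n)) ⟩
      1ℚ * H 2n ≡⟨ cong (_* H 2n) (sym two-half) ⟩
      ι 2 * half * H 2n ≡⟨ cong (λ v → v * half * H 2n) ι2 ⟩
      (1ℚ + 1ℚ) * half * H 2n ≡⟨ solve 2 (λ t h → (con 1ℚ :+ con 1ℚ) :* t :* h := t :* (h :+ h)) refl half (H 2n) ⟩
      half * (H 2n + H 2n) ∎

  H-reflection : ∀ a m → m ℕ.+ a ≡ 2n → ModP (H m) (H a)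
  H-reflection a m e = ModP-trans {H m} {H 2n + H a} (subst (λ v → ModP (H v) (H 2n + H a)) em (H-complement a a≤)) (ModP-trans {H 2n + H a} {0ℚ + H a} (ModP-+ {H 2n} {0ℚ} {H a} H2n≡0 ModP-refl) (ModP-≡ (ℚP.+-identityˡ (H a))))
    where
    a≤ : a ≤ 2n
    a≤ = subst (a ≤_) e (NP.m≤n+m a m)
    em : 2n ∸ a ≡ m
    em = trans (cong (_∸ a) (sym e)) (NP.m+n∸n≡m m a)

  open PartialFractions using (Πsh; Πf)

  Hodd : ℕ → ℚ
  Hodd k = Σ0 k (λ j → inv (ι (suc (j ℕ.+ j))))

  Z-Hodd : ∀ k → k ≤ n → Z (Hodd k)
  Z-Hodd k k≤n = Z-Σ k (λ j → inv (ι (suc (j ℕ.+ j)))) (λ j j<k → Z-inv {ι (suc (j ℕ.+ j))} (Un-odd j (NP.<-≤-trans j<k k≤n)))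

  pow2 : ∀ k → Π0 k (λ _ → ι 2) ≡ ι (2 ℕ.^ k)
  pow2 zero = refl
  pow2 (suc k) = trans (cong (_* ι 2) (pow2 k)) (trans (ℚP.*-comm (ι (2 ℕ.^ k)) (ι 2)) (sym (ι-* 2 (2 ℕ.^ k))))

  Πodd-unit : ∀ k → k ≤ n → Un (Πodd k)
  Πodd-unit k k≤n = Un-Π k (λ j → ι (suc (j ℕ.+ j))) (λ j j<k → Un-odd j (NP.<-≤-trans j<k k≤n))

  Πsh-n : Πsh n n ≡ Πodd n * ι (2 ℕ.^ n)
  Πsh-n = cancelR _ _ (ι (n ℕ.!)) (fact-nz n) (begin
    Πsh n n * ι (n ℕ.!) ≡⟨ ℚP.*-comm (Πsh n n) (ι (n ℕ.!)) ⟩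
    ι (n ℕ.!) * Πsh n n ≡⟨ cong₂ _*_ (fact-Π n) (Π0-cong n (λ j _ → cong (λ v → ι (suc v)) (NP.+-comm j n))) ⟩
    Π0 n (λ j → ι (suc j)) * Π0 n (λ j → ι (suc (n ℕ.+ j))) ≡⟨ sym (Π0-split n n (λ i → ι (suc i))) ⟩
    Π0 (n ℕ.+ n) (λ i → ι (suc i)) ≡⟨ split2 n ⟩
    Πodd n * Πev n ≡⟨ cong (Πodd n *_) (Πev-eq n) ⟩
    Πodd n * (ι (2 ℕ.^ n) * ι (n ℕ.!)) ≡⟨ sym (ℚP.*-assoc (Πodd n) (ι (2 ℕ.^ n)) (ι (n ℕ.!))) ⟩
    Πodd n * ι (2 ℕ.^ n) * ι (n ℕ.!) ∎)

  Pn : P ≡ 1ℚ + ι n + ι n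
  Pn = trans Peq (ι-odd n)

  -- 4^n = Π_{j<n} (2j+1+p)/(2j+1) ≡ 1 + p·Hodd n (mod p²).
  4^n-expansion : ModP² (ι (2 ℕ.^ n) * ι (2 ℕ.^ n)) (1ℚ + P * Hodd n)
  4^n-expansion = ModP²-trans {T * T} {iO * (Πodd n * (T * T))} (ModP²-≡ (sym eA))
            (ModP²-trans {iO * (Πodd n * (T * T))} {iO * (Πodd n * (1ℚ + P * Hodd n))} (ModP²-*Z {iO} (Z-inv {Πodd n} uO) ex') (ModP²-≡ eA))
    where
    T : ℚ
    T = ι (2 ℕ.^ n)
    iO : ℚ
    iO = inv (Πodd n)
    uO : Un (Πodd n)
    uO = Πodd-unit n NP.≤-refl
    eA : ∀ {X} → iO * (Πodd n * X) ≡ X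
    eA {X} = trans (sym (ℚP.*-assoc iO (Πodd n) X)) (trans (cong (_* X) (inv-l (Πodd n) (Un-nz {Πodd n} uO))) (ℚP.*-identityˡ X))
    ex : Ex (Π0 n (λ j → ι (suc (j ℕ.+ j)) + P * 1ℚ)) (Πodd n) (Σ0 n (λ j → 1ℚ * inv (ι (suc (j ℕ.+ j)))))
    ex = Ex-Π n (λ j → ι (suc (j ℕ.+ j))) (λ _ → 1ℚ) (λ j j<n → Un-odd j j<n) (λ _ _ → Z-1)
    lhs : Π0 n (λ j → ι (suc (j ℕ.+ j)) + P * 1ℚ) ≡ Πodd n * (T * T)
    lhs = begin
      Π0 n (λ j → ι (suc (j ℕ.+ j)) + P * 1ℚ) ≡⟨ Π0-cong n (λ j _ → term j) ⟩
      Π0 n (λ j → ι 2 * ι (suc (j ℕ.+ n))) ≡⟨ Π0-mul n (λ _ → ι 2) (λ j → ι (suc (j ℕ.+ n))) ⟩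
      Π0 n (λ _ → ι 2) * Πsh n n ≡⟨ cong₂ _*_ (pow2 n) Πsh-n ⟩
      T * (Πodd n * T) ≡⟨ solve 2 (λ t o → t :* (o :* t) := o :* (t :* t)) refl T (Πodd n) ⟩
      Πodd n * (T * T) ∎
      where
      term : ∀ j → ι (suc (j ℕ.+ j)) + P * 1ℚ ≡ ι 2 * ι (suc (j ℕ.+ n))
      term j = begin
        ι (suc (j ℕ.+ j)) + P * 1ℚ ≡⟨ cong₂ (λ a b → a + b * 1ℚ) (ι-odd j) Pn ⟩
        (1ℚ + ι j + ι j) + (1ℚ + ι n + ι n) * 1ℚ ≡⟨ solve 2 (λ x y → (con 1ℚ :+ x :+ x) :+ (con 1ℚ :+ y :+ y) :* con 1ℚ := (con 1ℚ :+ con 1ℚ) :* (con 1ℚ :+ (x :+ y))) refl (ι j) (ι n) ⟩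
        (1ℚ + 1ℚ) * (1ℚ + (ι j + ι n)) ≡⟨ cong₂ _*_ (sym ι2) (sym (trans (ι-suc (j ℕ.+ n)) (cong (1ℚ +_) (ι-+ j n)))) ⟩
        ι 2 * ι (suc (j ℕ.+ n)) ∎
    ex' : ModP² (Πodd n * (T * T)) (Πodd n * (1ℚ + P * Hodd n))
    ex' = subst₂ (λ X S → ModP² X (Πodd n * (1ℚ + P * S))) lhs (Σ0-cong n (λ j _ → ℚP.*-identityˡ _)) ex

  q₂≈Hodd : ModP (q2 p) (Hodd n)
  q₂≈Hodd = cancel-P (ModP²-trans {P * q2 p} {(1ℚ + P * q2 p) - 1ℚ} (ModP²-≡ (solve 2 (λ P q → P :* q := (con 1ℚ :+ P :* q) :- con 1ℚ) refl P (q2 p)))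
           (ModP²-trans {(1ℚ + P * q2 p) - 1ℚ} {(1ℚ + P * Hodd n) - 1ℚ} (ModP²-+ {1ℚ + P * q2 p} {1ℚ + P * Hodd n} { - 1ℚ} (ModP²-trans {1ℚ + P * q2 p} {ι (2 ℕ.^ n) * ι (2 ℕ.^ n)} (ModP²-≡ e1) 4^n-expansion) ModP²-refl)
              (ModP²-≡ (solve 2 (λ P o → (con 1ℚ :+ P :* o) :- con 1ℚ := P :* o) refl P (Hodd n)))))
    where
    pm1 : p ∸ 1 ≡ n ℕ.+ n
    pm1 = cong (_∸ 1) pn
    X : ℚ
    X = ι (2 ℕ.^ (p ∸ 1))
    eX : X ≡ ι (2 ℕ.^ n) * ι (2 ℕ.^ n)
    eX = trans (cong (λ v → ι (2 ℕ.^ v)) pm1) (trans (cong ι (NP.^-distribˡ-+-* 2 n n)) (ι-* (2 ℕ.^ n) (2 ℕ.^ n)))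
    e1 : 1ℚ + P * q2 p ≡ ι (2 ℕ.^ n) * ι (2 ℕ.^ n)
    e1 = begin
      1ℚ + P * ((X - 1ℚ) * inv P) ≡⟨ cong (1ℚ +_) (solve 3 (λ P a i → P :* (a :* i) := a :* (P :* i)) refl P (X - 1ℚ) (inv P)) ⟩
      1ℚ + (X - 1ℚ) * (P * inv P) ≡⟨ cong (λ v → 1ℚ + (X - 1ℚ) * v) (inv-r P P≢0) ⟩
      1ℚ + (X - 1ℚ) * 1ℚ ≡⟨ solve 1 (λ x → con 1ℚ :+ (x :- con 1ℚ) :* con 1ℚ := x) refl X ⟩
      X ≡⟨ eX ⟩
      ι (2 ℕ.^ n) * ι (2 ℕ.^ n) ∎

  inv2ev : ∀ i → ι 2 * inv (ι (suc (suc (i ℕ.+ i)))) ≡ inv (ι (suc i))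
  inv2ev i = begin
    ι 2 * inv (ι (suc (suc (i ℕ.+ i)))) ≡⟨ cong (λ v → ι 2 * inv v) (ev-eq i) ⟩
    ι 2 * inv (ι 2 * ι (suc i)) ≡⟨ cong (ι 2 *_) (inv-* (ι 2) (ι (suc i)) (Un-nz {ι 2} Un-2) (ι-nz i)) ⟩
    ι 2 * (half * inv (ι (suc i))) ≡⟨ sym (ℚP.*-assoc (ι 2) half (inv (ι (suc i)))) ⟩
    ι 2 * half * inv (ι (suc i)) ≡⟨ cong (_* inv (ι (suc i))) two-half ⟩
    1ℚ * inv (ι (suc i)) ≡⟨ ℚP.*-identityˡ _ ⟩
    inv (ι (suc i)) ∎

  -- 2·Hodd (n-i) ≡ 2·q_p(2) + H_i (mod p): the removed odd terms 1/(2k+1)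
  -- are ≡ -1/(2i+2) by inv-compl.
  Hodd-vs-q₂ : ∀ i → i ≤ n → ModP (ι 2 * Hodd (n ∸ i)) (ι 2 * q2 p + H i)
  Hodd-vs-q₂ zero _ = ModP-trans {ι 2 * Hodd n} {ι 2 * q2 p} (ModP-*Z {ι 2} (Z-ι 2) (ModP-sym q₂≈Hodd)) (ModP-≡ (sym (ℚP.+-identityʳ _)))
  Hodd-vs-q₂ (suc i) h = ModP-trans {ι 2 * Hodd k} {(ι 2 * q2 p + H i) - ι 2 * inv o}
      (ModP-trans {ι 2 * Hodd k} {ι 2 * Hodd (suc k) - ι 2 * inv o} (ModP-≡ e1)
        (ModP-+ {ι 2 * Hodd (suc k)} {ι 2 * q2 p + H i} { - (ι 2 * inv o)} (subst (λ v → ModP (ι 2 * Hodd v) (ι 2 * q2 p + H i)) ek (Hodd-vs-q₂ i (NP.<⇒≤ h))) ModP-refl))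
      (ModP-trans {(ι 2 * q2 p + H i) - ι 2 * inv o} {(ι 2 * q2 p + H i) - ι 2 * (- inv ev)}
        (ModP-+ {ι 2 * q2 p + H i} {ι 2 * q2 p + H i} { - (ι 2 * inv o)} ModP-refl (ModP-neg (ModP-*Z {ι 2} (Z-ι 2) (inv-compl o ev (Un-odd k k<n) (Un-ev i i<2n) sumP))))
        (ModP-≡ e2))
    where
    k : ℕ
    k = n ∸ suc i
    ek : n ∸ i ≡ suc k
    ek = ∸-peel n i h
    o : ℚ
    o = ι (suc (k ℕ.+ k))
    ev : ℚ
    ev = ι (suc (suc (i ℕ.+ i)))
    k<n : k < n
    k<n = NP.<-≤-trans (NP.n<1+n k) (subst (_≤ n) ek (NP.m∸n≤m n i))
    i<2n : i < n ℕ.+ n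
    i<2n = NP.<-≤-trans h (NP.m≤m+n n n)
    kin : k ℕ.+ suc i ≡ n
    kin = NP.m∸n+n≡m h
    sumP : o + ev ≡ P
    sumP = begin
      o + ev ≡⟨ cong₂ _+_ (ι-odd k) (ι-ev i) ⟩
      (1ℚ + ι k + ι k) + (1ℚ + 1ℚ + ι i + ι i) ≡⟨ solve 2 (λ a b → (con 1ℚ :+ a :+ a) :+ (con 1ℚ :+ con 1ℚ :+ b :+ b) := con 1ℚ :+ (a :+ (con 1ℚ :+ b)) :+ (a :+ (con 1ℚ :+ b))) refl (ι k) (ι i) ⟩
      1ℚ + (ι k + (1ℚ + ι i)) + (ι k + (1ℚ + ι i)) ≡⟨ cong (λ v → 1ℚ + v + v) (trans (cong (ι k +_) (sym (ι-suc i))) (trans (sym (ι-+ k (suc i))) (cong ι kin))) ⟩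
      1ℚ + ι n + ι n ≡⟨ sym Pn ⟩
      P ∎
    e1 : ι 2 * Hodd k ≡ ι 2 * Hodd (suc k) - ι 2 * inv o
    e1 = solve 3 (λ t a b → t :* a := t :* (a :+ b) :- t :* b) refl (ι 2) (Hodd k) (inv o)
    e2 : (ι 2 * q2 p + H i) - ι 2 * (- inv ev) ≡ ι 2 * q2 p + H (suc i)
    e2 = begin
      (ι 2 * q2 p + H i) - ι 2 * (- inv ev) ≡⟨ solve 4 (λ t q h e → (t :* q :+ h) :- t :* (:- e) := t :* q :+ (h :+ t :* e)) refl (ι 2) (q2 p) (H i) (inv ev) ⟩
      ι 2 * q2 p + (H i + ι 2 * inv ev) ≡⟨ cong (λ v → ι 2 * q2 p + (H i + v)) (inv2ev i) ⟩
      ι 2 * q2 p + H (suc i) ∎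


module BinomialCongruences (p : ℕ) (pr : Prime p) (n : ℕ) (pn : p ≡ suc (n ℕ.+ n)) where
  import Data.Nat.Properties as NP
  open import Relation.Binary.PropositionalEquality
  open import Data.Rational.Solver using (module +-*-Solver)
  open +-*-Solver
  open ≡-Reasoning
  open RationalField
  open IteratedOps
  open CentralBinomial
  open OddPrime p pr n pn
  open HarmonicFermat p pr n pn
  open PartialFractions using (Q; fN; Ev)

  Πev-unit : ∀ k → k ≤ n ℕ.+ n → Un (Πev k)
  Πev-unit k k≤ = Un-Π k (λ j → ι (suc (suc (j ℕ.+ j)))) (λ j j<k → Un-ev j (NP.<-≤-trans j<k k≤))

  -- γ n k = Π_{j<k} (p - (2j+1)) agrees up to sign with Π_{j<k} (2j+1 - p), which
  -- expands as Πodd k·(1 - p·Hodd k); hence  γ n k² ≡ Πodd k²·(1 - 2p·Hodd k)  (mod p²).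
  γ²-exp : ∀ k → k ≤ n → Ex (sq (γ n k)) (sq (Πodd k)) (- Hodd k + - Hodd k)
  γ²-exp k k≤n = subst (λ X → Ex X (sq (Πodd k)) (- Hodd k + - Hodd k)) (sym γ²-eq)
    (Ex-sq {Πodd-shift} {Πodd k} { - Hodd k} (Un⇒Z {Πodd k} (Πodd-unit k k≤n)) (Z-neg {Hodd k} (Z-Hodd k k≤n)) odd-shift-exp)
    where
    Πodd-shift : ℚ
    Πodd-shift = Π0 k (λ j → ι (suc (j ℕ.+ j)) + P * (- 1ℚ))
    odd-shift-exp : Ex Πodd-shift (Πodd k) (- Hodd k)
    odd-shift-exp = subst (Ex Πodd-shift (Πodd k)) sum-eq
      (Ex-Π k (λ j → ι (suc (j ℕ.+ j))) (λ _ → - 1ℚ) (λ j j<k → Un-odd j (NP.<-≤-trans j<k k≤n)) (λ _ _ → Z-neg {1ℚ} Z-1))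
      where
      sum-eq : Σ0 k (λ j → - 1ℚ * inv (ι (suc (j ℕ.+ j)))) ≡ - Hodd k
      sum-eq = trans (Σ0-scale k (- 1ℚ) _) (solve 1 (λ o → con (- 1ℚ) :* o := :- o) refl (Hodd k))
    γ²-eq : sq (γ n k) ≡ sq Πodd-shift
    γ²-eq = begin
      sq (γ n k)                                               ≡⟨ sq-Π k _ ⟩
      Π0 k (λ j → sq (ι (suc (n ℕ.+ n)) - ι (suc (j ℕ.+ j)))) ≡⟨ Π0-cong k (λ j _ → cong (λ v → sq (v - ι (suc (j ℕ.+ j)))) (sym Peq)) ⟩
      Π0 k (λ j → sq (P - ι (suc (j ℕ.+ j))))                  ≡⟨ Π0-cong k (λ j _ → solve 2 (λ P o → (P :- o) :* (P :- o) := (o :+ P :* con (- 1ℚ)) :* (o :+ P :* con (- 1ℚ))) refl P (ι (suc (j ℕ.+ j)))) ⟩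
      Π0 k (λ j → sq (ι (suc (j ℕ.+ j)) + P * (- 1ℚ)))         ≡⟨ sym (sq-Π k _) ⟩
      sq Πodd-shift                                            ∎

  -- c k ≡ C(n,k)²·(1 + 2p·Hodd k)  (mod p²): dividing γ²-exp by Πev k² gives
  -- C(n,k)² ≡ c k·(1 - 2p·Hodd k), which is then read backwards.
  c≈binom² : ∀ k → k ≤ n → Ex (c k) (sq (ι (n C k))) (ι 2 * Hodd k)
  c≈binom² k k≤n = Ex-shift {c k} {sq (ι (n C k))} { - (- Hodd k + - Hodd k)} {ι 2 * Hodd k} (Z-sq {ι (n C k)} (Z-ι (n C k)))
      (ModP-≡ (trans (solve 1 (λ o → :- (:- o :+ :- o) := (con 1ℚ :+ con 1ℚ) :* o) refl (Hodd k)) (cong (_* Hodd k) (sym ι2))))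
      (Ex-back {sq (ι (n C k))} {c k} { - Hodd k + - Hodd k} zc (Z-+ { - Hodd k} { - Hodd k} zmHodd zmHodd) binom²-exp)
    where
    E : ℚ
    E = Πev k
    iE : ℚ
    iE = inv E
    uE : Un E
    uE = Πev-unit k (NP.≤-trans k≤n (NP.m≤m+n n n))
    zc : Z (c k)
    zc = Z-≡ (sym (c-formula k)) (Z-sq {Πodd k * iE} (Z-* {Πodd k} {iE} (Un⇒Z {Πodd k} (Πodd-unit k k≤n)) (Z-inv {E} uE)))
    zmHodd : Z (- Hodd k)
    zmHodd = Z-neg {Hodd k} (Z-Hodd k k≤n)
    nCk-eq : ι (n C k) ≡ γ n k * iE
    nCk-eq = sym (div-eq (γ n k) (ι (n C k)) E (Un-nz {E} uE) (sym (binom-γ n k k≤n)))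
    binom²-exp : Ex (sq (ι (n C k))) (c k) (- Hodd k + - Hodd k)
    binom²-exp = subst₂ (λ X A → Ex X A (- Hodd k + - Hodd k)) iE²γ² iE²Πodd²
      (Ex-scale {sq (γ n k)} {sq (Πodd k)} { - Hodd k + - Hodd k} {sq iE} (Z-sq {iE} (Z-inv {E} uE)) (γ²-exp k k≤n))
      where
      iE²γ² : sq iE * sq (γ n k) ≡ sq (ι (n C k))
      iE²γ² = trans (solve 2 (λ a b → (a :* a) :* (b :* b) := (b :* a) :* (b :* a)) refl iE (γ n k)) (cong sq (sym nCk-eq))
      iE²Πodd² : sq iE * sq (Πodd k) ≡ c k
      iE²Πodd² = trans (solve 2 (λ a b → (a :* a) :* (b :* b) := (b :* a) :* (b :* a)) refl iE (Πodd k)) (sym (c-formula k))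

  oj : ℕ → ℚ
  oj j = ι (suc (j ℕ.+ j))
  ej : ℕ → ℚ
  ej j = ι (suc (suc (j ℕ.+ j)))

  c-prod : ∀ k → k ≤ n ℕ.+ n → c k ≡ Π0 k (λ j → sq (oj j) * inv (sq (ej j)))
  c-prod k k≤ = begin
    c k ≡⟨ c-formula k ⟩
    sq (Πodd k * inv (Πev k)) ≡⟨ solve 2 (λ a b → (a :* b) :* (a :* b) := (a :* a) :* (b :* b)) refl (Πodd k) (inv (Πev k)) ⟩
    sq (Πodd k) * sq (inv (Πev k)) ≡⟨ cong₂ (λ a b → a * sq b) (sq-Π k oj) (inv-Π k ej enz) ⟩
    Π0 k (λ j → sq (oj j)) * sq (Π0 k (λ j → inv (ej j))) ≡⟨ cong (Π0 k (λ j → sq (oj j)) *_) (trans (sq-Π k _) (Π0-cong k (λ j j<k → sym (inv-* (ej j) (ej j) (enz j j<k) (enz j j<k))))) ⟩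
    Π0 k (λ j → sq (oj j)) * Π0 k (λ j → inv (sq (ej j))) ≡⟨ sym (Π0-mul k _ _) ⟩
    Π0 k (λ j → sq (oj j) * inv (sq (ej j))) ∎
    where
    enz : ∀ j → j < k → ej j ≢ 0ℚ
    enz j _ = ι-nz (suc (j ℕ.+ j))

  -- c k ≡ Q n k (mod p²): the factors differ by p²/(2j+2)².
  c≈Q : ∀ k → k ≤ n → ModP² (c k) (Q n k)
  c≈Q k k≤n = ModP²-trans {c k} {Π0 k g} (ModP²-≡ (c-prod k k≤2n)) (ModP²-Π k g (fN n) (λ j j<k → ModP²-sym (term j (jlt j j<k))) zg (λ j j<k → ModP²-Z (term j (jlt j j<k)) (zg j j<k)))
    where
    k≤2n : k ≤ n ℕ.+ n
    k≤2n = NP.≤-trans k≤n (NP.m≤m+n n n)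
    jlt : ∀ j → j < k → j < n ℕ.+ n
    jlt j j<k = NP.<-≤-trans j<k k≤2n
    g : ℕ → ℚ
    g j = sq (oj j) * inv (sq (ej j))
    zg : ∀ j → j < k → Z (g j)
    zg j j<k = Z-* {sq (oj j)} {inv (sq (ej j))} (Z-sq {oj j} (Z-ι (suc (j ℕ.+ j)))) (Z-inv {sq (ej j)} (Un-* {ej j} {ej j} (Un-ev j (jlt j j<k)) (Un-ev j (jlt j j<k))))
    term : ∀ j → j < n ℕ.+ n → ModP² (fN n j) (g j)
    term j jl = mkModP² (- inv (sq (ej j))) (Z-neg {inv (sq (ej j))} (Z-inv {sq (ej j)} (Un-* {ej j} {ej j} (Un-ev j jl) (Un-ev j jl)))) (begin
      (sq (1ℚ + ι j + ι j) - sq (1ℚ + ι n + ι n)) * inv (sq (Ev j)) ≡⟨ cong₂ (λ a b → (sq a - sq b) * inv (sq (Ev j))) (sym (ι-odd j)) (sym Pn) ⟩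
      (sq (oj j) - sq P) * inv (sq (Ev j)) ≡⟨ cong (λ v → (sq (oj j) - sq P) * inv (sq v)) (sym (ι-ev j)) ⟩
      (sq (oj j) - sq P) * inv (sq (ej j)) ≡⟨ solve 3 (λ o P i → (o :* o :- P :* P) :* i := o :* o :* i :+ P :* P :* (:- i)) refl (oj j) P (inv (sq (ej j))) ⟩
      g j + P * P * - inv (sq (ej j)) ∎)

  -- For n < k ≤ 2n the product Πodd k contains the factor 2n+1 = p, so c k ≡ 0 (mod p²).
  c-vanishes : ∀ l → suc n ℕ.+ l ≤ n ℕ.+ n → ModP² (c (suc n ℕ.+ l)) 0ℚ
  c-vanishes l h = mkModP² (sq W) (Z-sq {W} zW) (begin
    c k ≡⟨ c-formula k ⟩
    sq (Πodd k * iE) ≡⟨ cong (λ v → sq (v * iE)) (Π0-split (suc n) l oj) ⟩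
    sq (Πodd n * oj n * R * iE) ≡⟨ cong (λ v → sq (Πodd n * v * R * iE)) (sym Peq) ⟩
    sq (Πodd n * P * R * iE) ≡⟨ solve 4 (λ a P r i → (a :* P :* r :* i) :* (a :* P :* r :* i) := con 0ℚ :+ P :* P :* ((a :* r :* i) :* (a :* r :* i))) refl (Πodd n) P R iE ⟩
    0ℚ + P * P * sq W ∎)
    where
    k : ℕ
    k = suc n ℕ.+ l
    iE : ℚ
    iE = inv (Πev k)
    R : ℚ
    R = Π0 l (λ j → oj (suc n ℕ.+ j))
    W : ℚ
    W = Πodd n * R * iE
    zW : Z W
    zW = Z-* {Πodd n * R} {iE} (Z-* {Πodd n} {R} (Un⇒Z {Πodd n} (Πodd-unit n NP.≤-refl)) (Z-Π l (λ j → oj (suc n ℕ.+ j)) (λ j _ → Z-ι (suc ((suc n ℕ.+ j) ℕ.+ (suc n ℕ.+ j)))))) (Z-inv {Πev k} (Πev-unit k h))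


-- Writing
-- f k = c k·p/(k + b):
--   A ≡ B      since c k ≡ 0 for n < k < p                      (A≡B);
--   B ≡ p·Σ_{k≤n} Q n k/(b+k) = p·N(b)/D(b)                    (partial fractions);
--   in D(b) = Π_{j≤n}(b+j) exactly the factor b + t = p(s+1) is divisible by p,
--   and expanding the remaining factors to first order gives B ≡ E   (B≡E);
--   finally c a ≡ c t·(1 - p·(H_t - H_a)) and C(n,t)² ≡ c t·(1 - 2p·q_p(2) - 2p·H_a)
--   rewrite E as C₁ and as D                                   (C₁≡E, D≡E).
module MainCongruences (p : ℕ) (pr : Prime p) (n : ℕ) (pn : p ≡ suc (n ℕ.+ n))
    (a t : ℕ) (at : a ℕ.+ t ≡ n) (b s : ℚ) (bs : b ≡ ι (suc (n ℕ.+ a)) + ι p * s)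
    (zs : PIntegers.Z p pr s) (us1 : PIntegers.Un p pr (s + 1ℚ)) where
  import Data.Nat.Properties as NP
  open import Data.Nat.Combinatorics using (nCk≡nC[n∸k])
  import Data.Rational.Properties as ℚP
  open import Relation.Binary.PropositionalEquality
  open import Relation.Nullary using (yes; no)
  open import Relation.Binary.Definitions using (tri<; tri≈; tri>)
  open import Data.Empty using (⊥-elim)
  open import Data.Rational.Solver using (module +-*-Solver)
  open +-*-Solver
  open ≡-Reasoning
  open RationalField
  open IteratedOps
  open CentralBinomial
  open OddPrime p pr n pn
  open HarmonicFermat p pr n pn
  open BinomialCongruences p pr n pn
  open PartialFractions using (Q; S; Num; Den; partial-fractions; Πsh; Πf; Πneg; Q-product)

  r : ℕ
  r = suc (n ℕ.+ a)

  zs1 : Z (s + 1ℚ)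
  zs1 = Un⇒Z {s + 1ℚ} us1

  t≤n : t ≤ n
  t≤n = subst (t ≤_) at (NP.m≤n+m t a)
  a≤n : a ≤ n
  a≤n = subst (a ≤_) at (NP.m≤m+n a t)

  r+t≡p : ι r + ι t ≡ P
  r+t≡p = trans (sym (ι-+ r t)) (trans (cong (λ v → ι (suc v)) (trans (NP.+-assoc n a t) (cong (n ℕ.+_) at))) (sym Peq))

  b+k≡ : ∀ k → b + ι k ≡ (ι k - ι t) + P * (s + 1ℚ)
  b+k≡ k = begin
    b + ι k ≡⟨ cong (_+ ι k) bs ⟩
    ι r + P * s + ι k ≡⟨ solve 5 (λ R P s k T → R :+ P :* s :+ k := (k :- T) :+ (R :+ T) :* (s :+ con 1ℚ) :+ (P :- (R :+ T)) :* s) refl (ι r) P s (ι k) (ι t) ⟩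
    (ι k - ι t) + (ι r + ι t) * (s + 1ℚ) + (P - (ι r + ι t)) * s ≡⟨ cong (λ v → (ι k - ι t) + v * (s + 1ℚ) + (P - v) * s) r+t≡p ⟩
    (ι k - ι t) + P * (s + 1ℚ) + (P - P) * s ≡⟨ solve 4 (λ u P s1 s → u :+ P :* s1 :+ (P :- P) :* s := u :+ P :* s1) refl (ι k - ι t) P (s + 1ℚ) s ⟩
    (ι k - ι t) + P * (s + 1ℚ) ∎

  b+t≡ : b + ι t ≡ P * (s + 1ℚ)
  b+t≡ = trans (b+k≡ t) (solve 3 (λ T P s1 → (T :- T) :+ P :* s1 := P :* s1) refl (ι t) P (s + 1ℚ))

  Un-k-t : ∀ k → k ≢ t → k ≤ n ℕ.+ n → Un (ι k - ι t)
  Un-k-t k k≢t k≤ with NP.<-cmp k t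
  ... | tri< k<t _ _ = Un-≡ e (Un-neg {ι (t ∸ k)} (Un-pos (t ∸ k) (NP.m<n⇒0<n∸m k<t) (NP.≤-trans (NP.m∸n≤m t k) (NP.≤-trans t≤n (NP.m≤m+n n n)))))
    where
    e : - ι (t ∸ k) ≡ ι k - ι t
    e = trans (cong -_ (ι-minus (NP.<⇒≤ k<t))) (solve 2 (λ a b → :- (a :- b) := b :- a) refl (ι t) (ι k))
  ... | tri≈ _ k≡t _ = ⊥-elim (k≢t k≡t)
  ... | tri> _ _ k>t = Un-≡ (ι-minus (NP.<⇒≤ k>t)) (Un-pos (k ∸ t) (NP.m<n⇒0<n∸m k>t) (NP.≤-trans (NP.m∸n≤m k t) k≤))

  Un-b+k : ∀ k → k ≢ t → k ≤ n ℕ.+ n → Un (b + ι k)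
  Un-b+k k k≢t k≤ = Un-≡ (sym (b+k≡ k)) (Un-lift {ι k - ι t} {s + 1ℚ} (Un-k-t k k≢t k≤) zs1)

  -- p/(k+b) ∈ ℤ_p for k ≤ n: it is 1/(s+1) for k = t and p·(unit) otherwise.
  Z-p/[k+b] : ∀ k → k ≤ n → Z (P * inv (ι k + b))
  Z-p/[k+b] k k≤n with k ℕ.≟ t
  ... | yes refl = Z-≡ (sym e) (Z-inv {s + 1ℚ} us1)
    where
    e : P * inv (ι t + b) ≡ inv (s + 1ℚ)
    e = begin
      P * inv (ι t + b) ≡⟨ cong (λ v → P * inv v) (trans (ℚP.+-comm (ι t) b) b+t≡) ⟩
      P * inv (P * (s + 1ℚ)) ≡⟨ cong (P *_) (inv-* P (s + 1ℚ) P≢0 (Un-nz {s + 1ℚ} us1)) ⟩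
      P * (inv P * inv (s + 1ℚ)) ≡⟨ sym (ℚP.*-assoc P (inv P) (inv (s + 1ℚ))) ⟩
      P * inv P * inv (s + 1ℚ) ≡⟨ cong (_* inv (s + 1ℚ)) (inv-r P P≢0) ⟩
      1ℚ * inv (s + 1ℚ) ≡⟨ ℚP.*-identityˡ _ ⟩
      inv (s + 1ℚ) ∎
  ... | no k≢t = Z-* {P} {inv (ι k + b)} Z-P (Z-inv {ι k + b} (Un-≡ (ℚP.+-comm b (ι k)) (Un-b+k k k≢t (NP.≤-trans k≤n (NP.m≤m+n n n)))))

  b+k≢0 : ∀ k → k ≤ n → b + ι k ≢ 0ℚ
  b+k≢0 k k≤n with k ℕ.≟ t
  ... | yes refl = λ e → mul-nz P (s + 1ℚ) P≢0 (Un-nz {s + 1ℚ} us1) (trans (sym b+t≡) e)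
  ... | no k≢t = Un-nz {b + ι k} (Un-b+k k k≢t (NP.≤-trans k≤n (NP.m≤m+n n n)))

  f : ℕ → ℚ
  f k = c k * (ι p // (ι k + b))

  -- A ≡ B (mod p²): the terms with n < k < p vanish.
  A≡B : ModP² (sumTo (p ∸ 1) f) (sumTo n f)
  A≡B = subst (λ v → ModP² (sumTo v f) (sumTo n f)) (sym (cong (_∸ 1) pn)) split-at-n
    where
    upper-half≡0 : ModP² (Σ0 n (λ j → f (suc n ℕ.+ j))) 0ℚ
    upper-half≡0 = ModP²-trans (ModP²-Σ n (λ j → f (suc n ℕ.+ j)) (λ _ → 0ℚ) term) (ModP²-≡ (Σ0-zero n))
      where
      term : ∀ j → j < n → ModP² (f (suc n ℕ.+ j)) 0ℚ
      term j j<n = ModP²-trans {f k} {0ℚ * (P * inv (ι k + b))} (ModP²-*Zʳ {P * inv (ι k + b)} zk (c-vanishes j k≤)) (ModP²-≡ (ℚP.*-zeroˡ (P * inv (ι k + b))))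
        where
        k : ℕ
        k = suc n ℕ.+ j
        k≤ : k ≤ n ℕ.+ n
        k≤ = subst (ℕ._≤ n ℕ.+ n) (NP.+-suc n j) (NP.+-monoʳ-≤ n j<n)
        k≢t : k ≢ t
        k≢t e = NP.<-irrefl (sym e) (NP.<-≤-trans (s≤s t≤n) (NP.m≤m+n (suc n) j))
        zk : Z (P * inv (ι k + b))
        zk = Z-* {P} {inv (ι k + b)} Z-P (Z-inv {ι k + b} (Un-≡ (ℚP.+-comm b (ι k)) (Un-b+k k k≢t k≤)))
    split-at-n : ModP² (sumTo (n ℕ.+ n) f) (sumTo n f)
    split-at-n = ModP²-trans {sumTo (n ℕ.+ n) f} {Σ0 (suc n) f + Σ0 n (λ j → f (suc n ℕ.+ j))}
      (ModP²-≡ (trans (sumTo-Σ0 (n ℕ.+ n) f) (Σ0-split (suc n) n f)))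
      (ModP²-trans (ModP²-+ {Σ0 (suc n) f} {Σ0 (suc n) f} ModP²-refl upper-half≡0) (ModP²-≡ (trans (ℚP.+-identityʳ _) (sym (sumTo-Σ0 n f)))))

  is1 : ℚ
  is1 = inv (s + 1ℚ)
  s1 : ℚ
  s1 = s + 1ℚ
  zis1 : Z is1
  zis1 = Z-inv {s1} us1

  B≡pS : ModP² (sumTo n f) (P * S n b)
  B≡pS = ModP²-trans {sumTo n f} {Σ0 (suc n) f} (ModP²-≡ (sumTo-Σ0 n f))
    (ModP²-trans (ModP²-Σ (suc n) f (λ k → P * (Q n k * inv (b + ι k))) term) (ModP²-≡ (Σ0-scale (suc n) P _)))
    where
    term : ∀ k → k < suc n → ModP² (f k) (P * (Q n k * inv (b + ι k)))
    term k k<sn = ModP²-trans (ModP²-*Zʳ {P * inv (ι k + b)} (Z-p/[k+b] k (NP.≤-pred k<sn)) (c≈Q k (NP.≤-pred k<sn)))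
      (ModP²-≡ (trans (cong (λ v → Q n k * (P * inv v)) (ℚP.+-comm (ι k) b)) (solve 3 (λ q P i → q :* (P :* i) := P :* (q :* i)) refl (Q n k) P (inv (b + ι k)))))

  pS≡pN/D : P * S n b ≡ P * (Num n b * inv (Den n b))
  pS≡pN/D = cong (P *_) (partial-fractions n b b+k≢0)

  Dlow : ℚ
  Dlow = Π0 t (λ j → b + ι j)
  Dmid : ℚ
  Dmid = b + ι (t ℕ.+ 0)
  Dhigh : ℚ
  Dhigh = Π0 a (λ i → b + ι (t ℕ.+ suc i))

  n+1≡t+a+1 : suc n ≡ t ℕ.+ suc a
  n+1≡t+a+1 = trans (cong suc (trans (sym at) (NP.+-comm a t))) (sym (NP.+-suc t a))

  Den-split : Den n b ≡ Dlow * (Dmid * Dhigh)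
  Den-split = trans (cong (λ v → Π0 v (λ j → b + ι j)) n+1≡t+a+1)
    (trans (Π0-split t (suc a) (λ j → b + ι j)) (cong (Dlow *_) (Π0-first a (λ i → b + ι (t ℕ.+ i)))))

  Dmid≡ : Dmid ≡ P * s1
  Dmid≡ = trans (cong (λ v → b + ι v) (NP.+-identityʳ t)) b+t≡

  b≡-t+p[s+1] : b ≡ - ι t + P * s1
  b≡-t+p[s+1] = trans (sym (ℚP.+-identityʳ b)) (trans (b+k≡ 0) (cong (_+ P * s1) (ℚP.+-identityˡ (- ι t))))

  -- First-order expansions of N(b) = Π_{j<n}(j+1-b) and of the two outer blocks of D(b),
  -- whose factors are (j+1+t) - p(s+1),  (j-t) + p(s+1),  (i+1) + p(s+1).
  Num-exp : Ex (Num n b) (Πsh n t) (Σ0 n (λ j → (- s1) * inv (ι (suc (j ℕ.+ t)))))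
  Num-exp = subst (λ X → Ex X (Πsh n t) (Σ0 n (λ j → (- s1) * inv (ι (suc (j ℕ.+ t))))))
    (Π0-cong n (λ j _ → sym (tm j)))
    (Ex-Π n (λ j → ι (suc (j ℕ.+ t))) (λ _ → - s1) (λ j j<n → Un-suc (j ℕ.+ t) (NP.+-mono-<-≤ j<n t≤n)) (λ _ _ → Z-neg {s1} zs1))
    where
    tm : ∀ j → ι (suc j) - b ≡ ι (suc (j ℕ.+ t)) + P * (- s1)
    tm j = begin
      ι (suc j) - b ≡⟨ cong (λ v → ι (suc j) - v) b≡-t+p[s+1] ⟩
      ι (suc j) - (- ι t + P * s1) ≡⟨ solve 4 (λ a T P s → a :- (:- T :+ P :* s) := (a :+ T) :+ P :* (:- s)) refl (ι (suc j)) (ι t) P s1 ⟩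
      (ι (suc j) + ι t) + P * (- s1) ≡⟨ cong (_+ P * (- s1)) (sym (ι-+ (suc j) t)) ⟩
      ι (suc (j ℕ.+ t)) + P * (- s1) ∎

  Dlow-exp : Ex Dlow (Π0 t (λ j → ι j - ι t)) (Σ0 t (λ j → s1 * inv (ι j - ι t)))
  Dlow-exp = subst (λ X → Ex X (Π0 t (λ j → ι j - ι t)) (Σ0 t (λ j → s1 * inv (ι j - ι t))))
    (Π0-cong t (λ j _ → sym (b+k≡ j)))
    (Ex-Π t (λ j → ι j - ι t) (λ _ → s1) (λ j j<t → Un-k-t j (λ e → NP.<-irrefl e j<t) (NP.≤-trans (NP.<⇒≤ j<t) (NP.≤-trans t≤n (NP.m≤m+n n n)))) (λ _ _ → zs1))

  Dhigh-exp : Ex Dhigh (Πf a) (Σ0 a (λ i → s1 * inv (ι (suc i))))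
  Dhigh-exp = subst (λ X → Ex X (Πf a) (Σ0 a (λ i → s1 * inv (ι (suc i)))))
    (Π0-cong a (λ i _ → sym (tm i)))
    (Ex-Π a (λ i → ι (suc i)) (λ _ → s1) (λ i i<a → Un-suc i (NP.<-≤-trans i<a (NP.≤-trans a≤n (NP.m≤m+n n n)))) (λ _ _ → zs1))
    where
    tm : ∀ i → b + ι (t ℕ.+ suc i) ≡ ι (suc i) + P * s1
    tm i = begin
      b + ι (t ℕ.+ suc i) ≡⟨ cong₂ _+_ b≡-t+p[s+1] (ι-+ t (suc i)) ⟩
      - ι t + P * s1 + (ι t + ι (suc i)) ≡⟨ solve 4 (λ T P s i → :- T :+ P :* s :+ (T :+ i) := i :+ P :* s) refl (ι t) P s1 (ι (suc i)) ⟩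
      ι (suc i) + P * s1 ∎

  Dlow₀ : ℚ
  Dlow₀ = Π0 t (λ j → ι j - ι t)
  Snum : ℚ
  Snum = Σ0 n (λ j → (- s1) * inv (ι (suc (j ℕ.+ t))))
  Slow : ℚ
  Slow = Σ0 t (λ j → s1 * inv (ι j - ι t))
  Shigh : ℚ
  Shigh = Σ0 a (λ i → s1 * inv (ι (suc i)))

  t≤2n : t ≤ n ℕ.+ n
  t≤2n = NP.≤-trans t≤n (NP.m≤m+n n n)
  a≤2n : a ≤ n ℕ.+ n
  a≤2n = NP.≤-trans a≤n (NP.m≤m+n n n)

  ukt : ∀ j → j < t → Un (ι j - ι t)
  ukt j j<t = Un-k-t j (λ e → NP.<-irrefl e j<t) (NP.≤-trans (NP.<⇒≤ j<t) t≤2n)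
  usi : ∀ i → i < a → Un (ι (suc i))
  usi i i<a = Un-suc i (NP.<-≤-trans i<a a≤2n)

  uDlow₀ : Un Dlow₀
  uDlow₀ = Un-Π t (λ j → ι j - ι t) ukt
  uΠf : Un (Πf a)
  uΠf = Un-Π a (λ i → ι (suc i)) usi
  zΠsh : Z (Πsh n t)
  zΠsh = Z-Π n (λ j → ι (suc (j ℕ.+ t))) (λ j _ → Z-ι (suc (j ℕ.+ t)))
  zSnum : Z Snum
  zSnum = Z-Σ n _ (λ j j<n → Z-* { - s1} {inv (ι (suc (j ℕ.+ t)))} (Z-neg {s1} zs1) (Z-inv {ι (suc (j ℕ.+ t))} (Un-suc (j ℕ.+ t) (NP.+-mono-<-≤ j<n t≤n))))
  zSlow : Z Slow
  zSlow = Z-Σ t _ (λ j j<t → Z-* {s1} {inv (ι j - ι t)} zs1 (Z-inv {ι j - ι t} (ukt j j<t)))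
  zShigh : Z Shigh
  zShigh = Z-Σ a _ (λ i i<a → Z-* {s1} {inv (ι (suc i))} zs1 (Z-inv {ι (suc i)} (usi i i<a)))

  uDlow : Un Dlow
  uDlow = Ex-Un {Dlow} {Dlow₀} {Slow} uDlow₀ zSlow Dlow-exp
  uDhigh : Un Dhigh
  uDhigh = Ex-Un {Dhigh} {Πf a} {Shigh} uΠf zShigh Dhigh-exp

  N : ℚ
  N = Num n b
  lead₁ : ℚ
  lead₁ = Πsh n t * inv Dlow₀
  lead : ℚ
  lead = lead₁ * inv (Πf a)

  N/Dlow-exp : Ex (N * inv Dlow) lead₁ (Snum + - Slow)
  N/Dlow-exp = Ex-mul {N} {inv Dlow} {Πsh n t} {inv Dlow₀} {Snum} { - Slow} zΠsh (Z-inv {Dlow₀} uDlow₀) zSnum (Z-neg {Slow} zSlow) Num-exp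
         (Ex-inv {Dlow} {Dlow₀} {Slow} uDlow₀ zSlow Dlow-exp)

  N/DlowDhigh-exp : Ex (N * inv Dlow * inv Dhigh) lead (Snum + - Slow + - Shigh)
  N/DlowDhigh-exp = Ex-mul {N * inv Dlow} {inv Dhigh} {lead₁} {inv (Πf a)} {Snum + - Slow} { - Shigh}
         (Z-* {Πsh n t} {inv Dlow₀} zΠsh (Z-inv {Dlow₀} uDlow₀)) (Z-inv {Πf a} uΠf)
         (Z-+ {Snum} { - Slow} zSnum (Z-neg {Slow} zSlow)) (Z-neg {Shigh} zShigh) N/Dlow-exp
         (Ex-inv {Dhigh} {Πf a} {Shigh} uΠf zShigh Dhigh-exp)

  zlead : Z lead
  zlead = Z-* {lead₁} {inv (Πf a)} (Z-* {Πsh n t} {inv Dlow₀} zΠsh (Z-inv {Dlow₀} uDlow₀)) (Z-inv {Πf a} uΠf)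
  zS₃ : Z (Snum + - Slow + - Shigh)
  zS₃ = Z-+ {Snum + - Slow} { - Shigh} (Z-+ {Snum} { - Slow} zSnum (Z-neg {Slow} zSlow)) (Z-neg {Shigh} zShigh)

  pN/D-exp₀ : Ex (N * inv Dlow * inv Dhigh * is1) (lead * is1) (Snum + - Slow + - Shigh + 0ℚ)
  pN/D-exp₀ = Ex-mul {N * inv Dlow * inv Dhigh} {is1} {lead} {is1} {Snum + - Slow + - Shigh} {0ℚ} zlead zis1 zS₃ Z-0 N/DlowDhigh-exp (Ex-refl {is1})

  -- The factor p cancels against b + t = p(s+1).
  pN/D≡ : P * (N * inv (Den n b)) ≡ N * inv Dlow * inv Dhigh * is1
  pN/D≡ = begin
    P * (N * inv (Den n b)) ≡⟨ cong (λ v → P * (N * inv v)) Den-split ⟩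
    P * (N * inv (Dlow * (Dmid * Dhigh))) ≡⟨ cong (λ v → P * (N * v)) (trans (inv-* Dlow (Dmid * Dhigh) nDlow (mul-nz Dmid Dhigh nDmid nDhigh)) (cong (inv Dlow *_) (inv-* Dmid Dhigh nDmid nDhigh))) ⟩
    P * (N * (inv Dlow * (inv Dmid * inv Dhigh))) ≡⟨ cong (λ v → P * (N * (inv Dlow * (inv v * inv Dhigh)))) Dmid≡ ⟩
    P * (N * (inv Dlow * (inv (P * s1) * inv Dhigh))) ≡⟨ cong (λ v → P * (N * (inv Dlow * (v * inv Dhigh)))) (inv-* P s1 P≢0 (Un-nz {s1} us1)) ⟩
    P * (N * (inv Dlow * ((inv P * is1) * inv Dhigh))) ≡⟨ solve 6 (λ P N a iP i b → P :* (N :* (a :* ((iP :* i) :* b))) := N :* a :* b :* i :* (P :* iP)) refl P N (inv Dlow) (inv P) is1 (inv Dhigh) ⟩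
    N * inv Dlow * inv Dhigh * is1 * (P * inv P) ≡⟨ cong (N * inv Dlow * inv Dhigh * is1 *_) (inv-r P P≢0) ⟩
    N * inv Dlow * inv Dhigh * is1 * 1ℚ ≡⟨ ℚP.*-identityʳ _ ⟩
    N * inv Dlow * inv Dhigh * is1 ∎
    where
    nDlow : Dlow ≢ 0ℚ
    nDlow = Un-nz {Dlow} uDlow
    nDhigh : Dhigh ≢ 0ℚ
    nDhigh = Un-nz {Dhigh} uDhigh
    nDmid : Dmid ≢ 0ℚ
    nDmid e = mul-nz P s1 P≢0 (Un-nz {s1} us1) (trans (sym Dmid≡) e)

  rev-t : ∀ j → j < t → ι (t ∸ suc j) - ι t ≡ - ι (suc j)
  rev-t j j<t = trans (cong (_- ι t) (ι-minus j<t)) (solve 2 (λ T a → (T :- a) :- T := :- a) refl (ι t) (ι (suc j)))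

  Dlow₀≡Πneg : Dlow₀ ≡ Πneg t
  Dlow₀≡Πneg = trans (sym (Π0-rev t (λ j → ι j - ι t))) (Π0-cong t rev-t)

  Slow≡ : Slow ≡ (- s1) * H t
  Slow≡ = begin
    Slow ≡⟨ sym (Σ0-rev t (λ j → s1 * inv (ι j - ι t))) ⟩
    Σ0 t (λ j → s1 * inv (ι (t ∸ suc j) - ι t)) ≡⟨ Σ0-cong t (λ j j<t → trans (cong (λ v → s1 * inv v) (rev-t j j<t)) (trans (cong (s1 *_) (inv-neg (ι (suc j)))) (solve 2 (λ s i → s :* (:- i) := (:- s) :* i) refl s1 (inv (ι (suc j)))))) ⟩
    Σ0 t (λ j → (- s1) * inv (ι (suc j))) ≡⟨ Σ0-scale t (- s1) _ ⟩
    (- s1) * Σ0 t (λ j → inv (ι (suc j))) ≡⟨ cong ((- s1) *_) (sym (H-Σ0 t)) ⟩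
    (- s1) * H t ∎

  Shigh≡ : Shigh ≡ s1 * H a
  Shigh≡ = trans (Σ0-scale a s1 _) (cong (s1 *_) (sym (H-Σ0 a)))

  Snum≡ : Snum ≡ (- s1) * (H (t ℕ.+ n) - H t)
  Snum≡ = begin
    Snum ≡⟨ Σ0-scale n (- s1) _ ⟩
    (- s1) * Σ0 n (λ j → inv (ι (suc (j ℕ.+ t)))) ≡⟨ cong ((- s1) *_) hs ⟩
    (- s1) * (H (t ℕ.+ n) - H t) ∎
    where
    hs : Σ0 n (λ j → inv (ι (suc (j ℕ.+ t)))) ≡ H (t ℕ.+ n) - H t
    hs = begin
      Σ0 n (λ j → inv (ι (suc (j ℕ.+ t)))) ≡⟨ solve 2 (λ x h → x := (h :+ x) :- h) refl _ (H t) ⟩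
      (H t + Σ0 n (λ j → inv (ι (suc (j ℕ.+ t))))) - H t ≡⟨ cong (λ v → (v + Σ0 n (λ j → inv (ι (suc (j ℕ.+ t))))) - H t) (H-Σ0 t) ⟩
      (Σ0 t (λ j → inv (ι (suc j))) + Σ0 n (λ j → inv (ι (suc (j ℕ.+ t))))) - H t ≡⟨ cong (λ v → (Σ0 t (λ j → inv (ι (suc j))) + v) - H t) (Σ0-cong n (λ j _ → cong (λ v → inv (ι (suc v))) (NP.+-comm j t))) ⟩
      (Σ0 t (λ j → inv (ι (suc j))) + Σ0 n (λ j → inv (ι (suc (t ℕ.+ j))))) - H t ≡⟨ cong (_- H t) (sym (Σ0-split t n (λ j → inv (ι (suc j))))) ⟩
      Σ0 (t ℕ.+ n) (λ j → inv (ι (suc j))) - H t ≡⟨ cong (_- H t) (sym (H-Σ0 (t ℕ.+ n))) ⟩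
      H (t ℕ.+ n) - H t ∎

  lead≡Q : lead ≡ Q n t
  lead≡Q = begin
    Πsh n t * inv Dlow₀ * inv (Πf a) ≡⟨ cong₂ (λ u v → u * inv v * inv (Πf a)) (sym (Q-product n t a (trans (NP.+-comm t a) at))) Dlow₀≡Πneg ⟩
    Q n t * Πneg t * Πf a * inv (Πneg t) * inv (Πf a) ≡⟨ solve 5 (λ q a f ia if → q :* a :* f :* ia :* if := q :* (a :* ia) :* (f :* if)) refl (Q n t) (Πneg t) (Πf a) (inv (Πneg t)) (inv (Πf a)) ⟩
    Q n t * (Πneg t * inv (Πneg t)) * (Πf a * inv (Πf a)) ≡⟨ cong₂ (λ u v → Q n t * u * v) (inv-r (Πneg t) nneg) (inv-r (Πf a) (Un-nz {Πf a} uΠf)) ⟩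
    Q n t * 1ℚ * 1ℚ ≡⟨ solve 1 (λ q → q :* con 1ℚ :* con 1ℚ := q) refl (Q n t) ⟩
    Q n t ∎
    where
    nneg : Πneg t ≢ 0ℚ
    nneg e = Un-nz {Dlow₀} uDlow₀ (trans Dlow₀≡Πneg e)

  -- The correction sum simplifies, using H_{t+n} ≡ H_a (mod p) since t + n + a = p - 1.
  S∞ : ℚ
  S∞ = (ι 2 * s + ι 2) * (H t - H a)

  t+n+a≡2n : t ℕ.+ n ℕ.+ a ≡ n ℕ.+ n
  t+n+a≡2n = trans (cong (ℕ._+ a) (NP.+-comm t n)) (trans (NP.+-assoc n t a) (cong (n ℕ.+_) (trans (NP.+-comm t a) at)))

  S-simplify : ModP (Snum + - Slow + - Shigh + 0ℚ) S∞
  S-simplify = ModP-trans {Snum + - Slow + - Shigh + 0ℚ} {(- s1) * H (t ℕ.+ n) + rest}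
    (ModP-≡ e1) (ModP-trans {(- s1) * H (t ℕ.+ n) + rest} {(- s1) * H a + rest}
      (ModP-+ {(- s1) * H (t ℕ.+ n)} {(- s1) * H a} {rest} (ModP-*Z { - s1} (Z-neg {s1} zs1) (H-reflection a (t ℕ.+ n) t+n+a≡2n)) ModP-refl)
      (ModP-≡ e2))
    where
    rest : ℚ
    rest = s1 * H t + s1 * H t - s1 * H a
    e1 : Snum + - Slow + - Shigh + 0ℚ ≡ (- s1) * H (t ℕ.+ n) + rest
    e1 = begin
      Snum + - Slow + - Shigh + 0ℚ ≡⟨ cong₂ (λ u v → u + - v + - Shigh + 0ℚ) Snum≡ Slow≡ ⟩
      (- s1) * (H (t ℕ.+ n) - H t) + - ((- s1) * H t) + - Shigh + 0ℚ ≡⟨ cong (λ v → (- s1) * (H (t ℕ.+ n) - H t) + - ((- s1) * H t) + - v + 0ℚ) Shigh≡ ⟩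
      (- s1) * (H (t ℕ.+ n) - H t) + - ((- s1) * H t) + - (s1 * H a) + 0ℚ ≡⟨ solve 4 (λ s x y z → (:- s) :* (x :- y) :+ (:- ((:- s) :* y)) :+ (:- (s :* z)) :+ con 0ℚ := (:- s) :* x :+ (s :* y :+ s :* y :- s :* z)) refl s1 (H (t ℕ.+ n)) (H t) (H a) ⟩
      (- s1) * H (t ℕ.+ n) + rest ∎
    e2 : (- s1) * H a + rest ≡ S∞
    e2 = begin
      (- s1) * H a + rest ≡⟨ solve 3 (λ s y z → (:- (s :+ con 1ℚ)) :* z :+ ((s :+ con 1ℚ) :* y :+ (s :+ con 1ℚ) :* y :- (s :+ con 1ℚ) :* z) := ((con 1ℚ :+ con 1ℚ) :* s :+ (con 1ℚ :+ con 1ℚ)) :* (y :- z)) refl s (H t) (H a) ⟩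
      ((1ℚ + 1ℚ) * s + (1ℚ + 1ℚ)) * (H t - H a) ≡⟨ cong (λ v → (v * s + v) * (H t - H a)) (sym ι2) ⟩
      S∞ ∎

  zHt : Z (H t)
  zHt = Z-≡ (sym (H-Σ0 t)) (Z-Σ t _ (λ j j<t → Z-inv {ι (suc j)} (Un-suc j (NP.<-≤-trans j<t t≤2n))))
  zHa : Z (H a)
  zHa = Z-≡ (sym (H-Σ0 a)) (Z-Σ a _ (λ j j<a → Z-inv {ι (suc j)} (Un-suc j (NP.<-≤-trans j<a a≤2n))))
  zS∞ : Z S∞
  zS∞ = Z-* {ι 2 * s + ι 2} {H t - H a} (Z-+ {ι 2 * s} {ι 2} (Z-* {ι 2} {s} (Z-ι 2) zs) (Z-ι 2)) (Z-- {H t} {H a} zHt zHa)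

  pN/D-exp : Ex (P * (N * inv (Den n b))) (c t * is1) S∞
  pN/D-exp = Ex-base {P * (N * inv (Den n b))} {Q n t * is1} {c t * is1} {S∞} zS∞ (ModP²-*Zʳ {is1} zis1 (ModP²-sym (c≈Q t t≤n)))
    (Ex-shift {P * (N * inv (Den n b))} {Q n t * is1} {Snum + - Slow + - Shigh + 0ℚ} {S∞} (Z-* {Q n t} {is1} zQ zis1) S-simplify
      (subst₂ (λ X A → Ex X A (Snum + - Slow + - Shigh + 0ℚ)) (sym pN/D≡) (cong (_* is1) lead≡Q) pN/D-exp₀))
    where
    zQ : Z (Q n t)
    zQ = Z-≡ lead≡Q zlead

  E-expr : ℚ
  E-expr = (c t // (s + 1ℚ)) * (1ℚ + ι p * (ι 2 * s + ι 2) * (H t - H a))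

  B≡E : ModP² (sumTo n f) E-expr
  B≡E = ModP²-trans B≡pS (ModP²-trans (ModP²-≡ pS≡pN/D) (ModP²-trans pN/D-exp (ModP²-≡ (solve 5 (λ c i P x y → c :* i :* (con 1ℚ :+ P :* (x :* y)) := c :* i :* (con 1ℚ :+ P :* x :* y)) refl (c t) is1 P (ι 2 * s + ι 2) (H t - H a)))))

  q₂ : ℚ
  q₂ = q2 p
  β : ℚ
  β = sq (ι (n C t))

  zq₂ : Z q₂
  zq₂ = ModP-Z q₂≈Hodd (Z-Hodd n NP.≤-refl)
  zβ : Z β
  zβ = Z-sq {ι (n C t)} (Z-ι (n C t))
  zct : Z (c t)
  zct = ModP²-Z (c≈Q t t≤n) (Z-≡ lead≡Q zlead)
  2q₂+ : ℚ → ℚ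
  2q₂+ x = ι 2 * q₂ + x
  z2q₂+Ha : Z (2q₂+ (H a))
  z2q₂+Ha = Z-+ {ι 2 * q₂} {H a} (Z-* {ι 2} {q₂} (Z-ι 2) zq₂) zHa
  z2q₂+Ht : Z (2q₂+ (H t))
  z2q₂+Ht = Z-+ {ι 2 * q₂} {H t} (Z-* {ι 2} {q₂} (Z-ι 2) zq₂) zHt

  nCa≡nCt : n C a ≡ n C t
  nCa≡nCt = trans (nCk≡nC[n∸k] a≤n) (cong (n C_) (trans (cong (_∸ a) (sym at)) (NP.m+n∸m≡n a t)))

  n∸t : n ∸ t ≡ a
  n∸t = trans (cong (_∸ t) (sym at)) (NP.m+n∸n≡m a t)
  n∸a : n ∸ a ≡ t
  n∸a = trans (cong (_∸ a) (sym at)) (NP.m+n∸m≡n a t)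

  c-a-exp : Ex (c a) β (2q₂+ (H t))
  c-a-exp = Ex-shift {c a} {β} {ι 2 * Hodd a} {2q₂+ (H t)} zβ (subst (λ v → ModP (ι 2 * Hodd v) (2q₂+ (H t))) n∸t (Hodd-vs-q₂ t t≤n))
         (subst (λ v → Ex (c a) (sq (ι v)) (ι 2 * Hodd a)) nCa≡nCt (c≈binom² a a≤n))

  c-t-exp : Ex (c t) β (2q₂+ (H a))
  c-t-exp = Ex-shift {c t} {β} {ι 2 * Hodd t} {2q₂+ (H a)} zβ (subst (λ v → ModP (ι 2 * Hodd v) (2q₂+ (H a))) n∸a (Hodd-vs-q₂ a a≤n)) (c≈binom² t t≤n)

  β-exp : Ex β (c t) (- 2q₂+ (H a))
  β-exp = Ex-back {c t} {β} {2q₂+ (H a)} zβ z2q₂+Ha c-t-exp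

  c-a-vs-c-t : Ex (c a) (c t) (- 2q₂+ (H a) + 2q₂+ (H t))
  c-a-vs-c-t = Ex-trans {c a} {β} {c t} {2q₂+ (H t)} { - 2q₂+ (H a)} zct z2q₂+Ht (Z-neg {2q₂+ (H a)} z2q₂+Ha) c-a-exp β-exp

  Ex-trivial : ∀ W → Ex (1ℚ + P * W) 1ℚ W
  Ex-trivial W = ModP²-≡ (sym (ℚP.*-identityˡ _))

  C₁-expr : ℚ
  C₁-expr = (c a // (s + 1ℚ)) * (1ℚ + ι p * (ι 2 * s + 1ℚ) * (H t - H a))
  W1 : ℚ
  W1 = (ι 2 * s + 1ℚ) * (H t - H a)
  zW1 : Z W1
  zW1 = Z-* {ι 2 * s + 1ℚ} {H t - H a} (Z-+ {ι 2 * s} {1ℚ} (Z-* {ι 2} {s} (Z-ι 2) zs) Z-1) (Z-- {H t} {H a} zHt zHa)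

  C₁≡E : ModP² C₁-expr E-expr
  C₁≡E = ModP²-trans {C₁-expr} {c a * is1 * (1ℚ + P * W1)} (ModP²-≡ (solve 5 (λ c i P x y → c :* i :* (con 1ℚ :+ P :* x :* y) := c :* i :* (con 1ℚ :+ P :* (x :* y))) refl (c a) is1 P (ι 2 * s + 1ℚ) (H t - H a)))
    (ModP²-trans expanded (ModP²-≡ E-form))
    where
    Sat : ℚ
    Sat = - 2q₂+ (H a) + 2q₂+ (H t)
    zSat : Z Sat
    zSat = Z-+ { - 2q₂+ (H a)} {2q₂+ (H t)} (Z-neg {2q₂+ (H a)} z2q₂+Ha) z2q₂+Ht
    lead-exp : Ex (c a * is1) (c t * is1) (Sat + 0ℚ)
    lead-exp = Ex-mul {c a} {is1} {c t} {is1} {Sat} {0ℚ} zct zis1 zSat Z-0 c-a-vs-c-t (Ex-refl {is1})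
    full-exp : Ex (c a * is1 * (1ℚ + P * W1)) (c t * is1 * 1ℚ) (Sat + 0ℚ + W1)
    full-exp = Ex-mul {c a * is1} {1ℚ + P * W1} {c t * is1} {1ℚ} {Sat + 0ℚ} {W1} (Z-* {c t} {is1} zct zis1) Z-1 (Z-+ {Sat} {0ℚ} zSat Z-0) zW1 lead-exp (Ex-trivial W1)
    correction≡S∞ : Sat + 0ℚ + W1 ≡ S∞
    correction≡S∞ = trans (solve 4 (λ tq x y s → (:- (tq :+ y) :+ (tq :+ x)) :+ con 0ℚ :+ ((con 1ℚ :+ con 1ℚ) :* s :+ con 1ℚ) :* (x :- y) := ((con 1ℚ :+ con 1ℚ) :* s :+ (con 1ℚ :+ con 1ℚ)) :* (x :- y)) refl (ι 2 * q₂) (H t) (H a) s) (cong (λ v → (v * s + v) * (H t - H a)) (sym ι2))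
    expanded : ModP² (c a * is1 * (1ℚ + P * W1)) (c t * is1 * 1ℚ * (1ℚ + P * S∞))
    expanded = subst (λ S → Ex (c a * is1 * (1ℚ + P * W1)) (c t * is1 * 1ℚ) S) correction≡S∞ full-exp
    E-form : c t * is1 * 1ℚ * (1ℚ + P * S∞) ≡ E-expr
    E-form = solve 5 (λ c i P x y → c :* i :* con 1ℚ :* (con 1ℚ :+ P :* (x :* y)) := c :* i :* (con 1ℚ :+ P :* x :* y)) refl (c t) is1 P (ι 2 * s + ι 2) (H t - H a)

  D-expr : ℚ
  D-expr = inv (s + 1ℚ) * ι ((n C t) ℕ.^ 2) * (1ℚ + ι p * (ι 2 * q2 p + (ι 2 * s + ι 2) * H t - (ι 2 * s + 1ℚ) * H a))
  W2 : ℚ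
  W2 = ι 2 * q₂ + (ι 2 * s + ι 2) * H t - (ι 2 * s + 1ℚ) * H a
  zW2 : Z W2
  zW2 = Z-- {ι 2 * q₂ + (ι 2 * s + ι 2) * H t} {(ι 2 * s + 1ℚ) * H a}
          (Z-+ {ι 2 * q₂} {(ι 2 * s + ι 2) * H t} (Z-* {ι 2} {q₂} (Z-ι 2) zq₂) (Z-* {ι 2 * s + ι 2} {H t} (Z-+ {ι 2 * s} {ι 2} (Z-* {ι 2} {s} (Z-ι 2) zs) (Z-ι 2)) zHt))
          (Z-* {ι 2 * s + 1ℚ} {H a} (Z-+ {ι 2 * s} {1ℚ} (Z-* {ι 2} {s} (Z-ι 2) zs) Z-1) zHa)

  D≡E : ModP² D-expr E-expr
  D≡E = ModP²-trans {D-expr} {is1 * β * (1ℚ + P * W2)} (ModP²-≡ (cong (λ v → is1 * v * (1ℚ + P * W2)) (ι-sq (n C t))))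
    (ModP²-trans expanded (ModP²-≡ E-form))
    where
    lead-exp : Ex (is1 * β) (is1 * c t) (- 2q₂+ (H a))
    lead-exp = Ex-scale {β} {c t} { - 2q₂+ (H a)} {is1} zis1 β-exp
    full-exp : Ex (is1 * β * (1ℚ + P * W2)) (is1 * c t * 1ℚ) (- 2q₂+ (H a) + W2)
    full-exp = Ex-mul {is1 * β} {1ℚ + P * W2} {is1 * c t} {1ℚ} { - 2q₂+ (H a)} {W2} (Z-* {is1} {c t} zis1 zct) Z-1 (Z-neg {2q₂+ (H a)} z2q₂+Ha) zW2 lead-exp (Ex-trivial W2)
    correction≡S∞ : - 2q₂+ (H a) + W2 ≡ S∞
    correction≡S∞ = trans (solve 4 (λ tq x y s → :- (tq :+ y) :+ (tq :+ ((con 1ℚ :+ con 1ℚ) :* s :+ (con 1ℚ :+ con 1ℚ)) :* x :- ((con 1ℚ :+ con 1ℚ) :* s :+ con 1ℚ) :* y) := ((con 1ℚ :+ con 1ℚ) :* s :+ (con 1ℚ :+ con 1ℚ)) :* (x :- y)) refl (ι 2 * q₂) (H t) (H a) s) (cong (λ v → (v * s + v) * (H t - H a)) (sym ι2))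
    expanded : ModP² (is1 * β * (1ℚ + P * W2)) (is1 * c t * 1ℚ * (1ℚ + P * S∞))
    expanded = subst (λ S → Ex (is1 * β * (1ℚ + P * W2)) (is1 * c t * 1ℚ) S) correction≡S∞ full-exp
    E-form : is1 * c t * 1ℚ * (1ℚ + P * S∞) ≡ E-expr
    E-form = solve 5 (λ c i P x y → i :* c :* con 1ℚ :* (con 1ℚ :+ P :* (x :* y)) := c :* i :* (con 1ℚ :+ P :* x :* y)) refl (c t) is1 P (ι 2 * s + ι 2) (H t - H a)


module StatementBridge (p : ℕ) (pr : Prime p) where
  import Data.Nat.Properties as NP
  open import Relation.Binary.PropositionalEquality
  open import Data.Rational.Solver using (module +-*-Solver)
  open +-*-Solver
  open ≡-Reasoning
  open RationalField
  open PIntegers p pr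
  open Congruences p pr

  ι-p¹ : ι (p ℕ.^ 1) ≡ P
  ι-p¹ = cong ι (NP.*-identityʳ p)

  ι-p² : ι (p ℕ.^ 2) ≡ P * P
  ι-p² = trans (ι-* p (p ℕ.* 1)) (cong (P *_) ι-p¹)

  toCong2 : ∀ {x y} → ModP² x y → Cong p 2 x y
  toCong2 {x} {y} (mkModP² w zw e) = subst (InZp p) (sym eq) (Z⇒InZp zw)
    where
    eq : (x - y) // ι (p ℕ.^ 2) ≡ w
    eq = begin
      (x - y) * inv (ι (p ℕ.^ 2)) ≡⟨ cong₂ (λ u v → (u - y) * inv v) e ι-p² ⟩
      (y + P * P * w - y) * inv (P * P) ≡⟨ div-eq _ w (P * P) (mul-nz P P P≢0 P≢0) (solve 3 (λ y P w → y :+ P :* P :* w :- y := w :* (P :* P)) refl y P w) ⟩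
      w ∎

  toCong1 : ∀ {x y} → ModP x y → Cong p 1 x y
  toCong1 {x} {y} (mkModP w zw e) = subst (InZp p) (sym eq) (Z⇒InZp zw)
    where
    eq : (x - y) // ι (p ℕ.^ 1) ≡ w
    eq = begin
      (x - y) * inv (ι (p ℕ.^ 1)) ≡⟨ cong₂ (λ u v → (u - y) * inv v) e ι-p¹ ⟩
      (y + P * w - y) * inv P ≡⟨ div-eq _ w P P≢0 (solve 3 (λ y P w → y :+ P :* w :- y := w :* P) refl y P w) ⟩
      w ∎

  Cong1⇒digit : ∀ {x y} → Cong p 1 x y → Z ((x - y) // P)
  Cong1⇒digit {x} {y} cg = InZp⇒Z (subst (λ v → InZp p ((x - y) // v)) ι-p¹ cg)

  digit-expansion : ∀ x y → x ≡ y + P * ((x - y) // P)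
  digit-expansion x y = begin
    x ≡⟨ solve 2 (λ x y → x := y :+ (x :- y)) refl x y ⟩
    y + (x - y) ≡⟨ cong (y +_) (sym (div-eq ((x - y) * P) (x - y) P P≢0 refl)) ⟩
    y + (x - y) * P * inv P ≡⟨ cong (y +_) (solve 3 (λ d P i → d :* P :* i := P :* (d :* i)) refl (x - y) P (inv P)) ⟩
    y + P * ((x - y) // P) ∎

  succ-unit : ∀ {s} → Z s → ¬ Cong p 1 s (- 1ℚ) → Un (s + 1ℚ)
  succ-unit {s} zs s≢-1 = Z-unit {s + 1ℚ} (Z-+ {s} {1ℚ} zs Z-1) (λ e → s≢-1 (toCong1 (shift e)))
    where
    shift : ModP (s + 1ℚ) 0ℚ → ModP s (- 1ℚ)
    shift e = ModP-trans {s} {s + 1ℚ + - 1ℚ} (ModP-≡ (solve 1 (λ s → s := s :+ con 1ℚ :+ con (- 1ℚ)) refl s))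
               (ModP-trans {s + 1ℚ + - 1ℚ} {0ℚ + - 1ℚ} (ModP-+ {s + 1ℚ} {0ℚ} { - 1ℚ} e ModP-refl) (ModP-≡ (ℚP.+-identityˡ (- 1ℚ))))
      where import Data.Rational.Properties as ℚP

module Residue (p : ℕ) (p-odd : p % 2 ≡ 1) (r : ℕ) (r<p : r < p) (p<2r : p < 2 ℕ.* r) where
  import Data.Nat.Properties as NP
  import Data.Nat.DivMod as DM
  open import Data.Nat.Solver using (module +-*-Solver)
  open import Relation.Binary.PropositionalEquality
  open +-*-Solver

  n : ℕ
  n = (p ∸ 1) / 2
  a : ℕ
  a = r ∸ (p ℕ.+ 1) / 2
  t : ℕ
  t = p ∸ r

  p≡2n+1 : p ≡ suc (n ℕ.+ n)
  p≡2n+1 = trans p≡1+2k (cong (λ v → suc (v ℕ.+ v)) (sym n≡k))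
    where
    k : ℕ
    k = p / 2
    p≡1+k2 : p ≡ 1 ℕ.+ k ℕ.* 2
    p≡1+k2 = trans (DM.m≡m%n+[m/n]*n p 2) (cong (ℕ._+ k ℕ.* 2) p-odd)
    p≡1+2k : p ≡ suc (k ℕ.+ k)
    p≡1+2k = trans p≡1+k2 (cong suc (solve 1 (λ k → k :* con 2 := k :+ k) refl k))
    n≡k : n ≡ k
    n≡k = trans (cong (λ v → (v ∸ 1) / 2) p≡1+k2) (DM.m*n/n≡m k 2)

  half-p+1 : (p ℕ.+ 1) / 2 ≡ suc n
  half-p+1 = trans (cong (λ v → (v ℕ.+ 1) / 2) p≡2n+1)
    (trans (cong (_/ 2) (solve 1 (λ n → con 1 :+ (n :+ n) :+ con 1 := (con 1 :+ n) :* con 2) refl n)) (DM.m*n/n≡m (suc n) 2))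

  n<r : n < r
  n<r = NP.≰⇒> (λ r≤n → NP.<-irrefl refl (NP.<-≤-trans p<2r (2r≤p r≤n)))
    where
    2r≤p : r ℕ.≤ n → 2 ℕ.* r ℕ.≤ p
    2r≤p r≤n = NP.≤-trans (NP.*-monoʳ-≤ 2 r≤n)
      (subst (2 ℕ.* n ℕ.≤_) (sym p≡2n+1) (NP.≤-trans (NP.≤-reflexive (cong (n ℕ.+_) (NP.+-identityʳ n))) (NP.n≤1+n (n ℕ.+ n))))

  r≡n+1+a : suc (n ℕ.+ a) ≡ r
  r≡n+1+a = trans (cong (λ v → suc (n ℕ.+ (r ∸ v))) half-p+1) (NP.m+[n∸m]≡n n<r)

  a+t≡n : a ℕ.+ t ≡ n
  a+t≡n = NP.+-cancelˡ-≡ (suc n) (a ℕ.+ t) n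
    (trans (sym (NP.+-assoc (suc n) a t)) (trans (cong (ℕ._+ t) r≡n+1+a) (trans (NP.m+[n∸m]≡n (NP.<⇒≤ r<p)) p≡2n+1)))

theorem4p1 : (p : ℕ) → Prime p → p % 2 ≡ 1 →
    (b : ℚ) → InZp p b →
    (r : ℕ) → r < p → Cong p 1 b (ι r) → p < 2 Data.Nat.* r →
    let s = (b - ι r) // ι p
        m = (p Data.Nat.+ 1) / 2
        a = r ∸ m
        t = p ∸ r
        h = (p ∸ 1) / 2
        f = λ (k : ℕ) → c k * (ι p // (ι k + b))
        A = sumTo (p ∸ 1) f
        B = sumTo h f
        C₁ = (c a // (s + 1ℚ)) * (1ℚ + ι p * (ι 2 * s + 1ℚ) * (H t - H a))
        D = inv (s + 1ℚ) * ι ((h C t) Data.Nat.^ 2)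
              * (1ℚ + ι p * (ι 2 * q2 p + (ι 2 * s + ι 2) * H t - (ι 2 * s + 1ℚ) * H a))
        E = (c t // (s + 1ℚ)) * (1ℚ + ι p * (ι 2 * s + ι 2) * (H t - H a))
    in ¬ Cong p 1 s (- 1ℚ) →
       Cong p 2 A B × Cong p 2 B C₁ × Cong p 2 C₁ D × Cong p 2 D E
theorem4p1 p pr p-odd b _ r r<p b≡r p<2r s≢-1 =
  toCong2 A≡B ,
  toCong2 (ModP²-trans B≡E (ModP²-sym C₁≡E)) ,
  toCong2 (ModP²-trans C₁≡E (ModP²-sym D≡E)) ,
  toCong2 D≡E
  where
  open import Relation.Binary.PropositionalEquality using (subst; sym)
  open PIntegers p pr
  open Congruences p pr
  open StatementBridge p pr
  open Residue p p-odd r r<p p<2r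
  s : ℚ
  s = (b - ι r) // ι p
  s-integral : Z s
  s-integral = Cong1⇒digit {b} {ι r} b≡r
  b≡r+ps : b ≡ ι (suc (n ℕ.+ a)) + P * s
  b≡r+ps = subst (λ v → b ≡ ι v + P * s) (sym r≡n+1+a) (digit-expansion b (ι r))
  open MainCongruences p pr n p≡2n+1 a t a+t≡n b s b≡r+ps s-integral (succ-unit s-integral s≢-1)
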